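{- Let $S=\{k^2:k\in\mathbb{N}\}$ and let $\bar S$ be its reciprocal. Let $n\in\mathbb{N}$. (1) If $n$ is even, then $n\in\bar S$ if and only if $n=2k^2$ for some $k\in\mathbb{N}$. (2) If $n\equiv1\pmod4$ and $n$ is not a perfect square, then $n\in\bar S$ if and only if $\nu_p(n)$ is even for every prime $p$ except exactly one prime $p_0$, and $p_0\equiv1\pmod 4$ and $\nu_{p_0}(n)\equiv1\pmod4$. (3) If $n\equiv1\pmod4$ and $n$ is a perfect square, then $n\in\bar S$ if and only if the number of primes $p\equiv1\pmod4$ with $\nu_p(n)\equiv2\pmod4$ is even.
   Context: $\mathbb{N}=\{0,1,2,\dots\}$. For $A\subseteq\mathbb{N}$ with $0\in A$, the reciprocal $\bar A$ is the unique set $B\subseteq\mathbb{N}$ with $\big(\sum_{a\in A}q^a\big)\big(\sum_{b\in B}q^b\big)=1$ in $\mathbb{F}_2[[q]]$; equivalently every positive integer has an even number of representations $a+b$ with $a\in A$, $b\in B$. For a prime $p$ and positive integer $n$, $\nu_p(n)$ is the exponent of $p$ in the prime factorization of $n$. -}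

module Defs where

open import Data.Nat using (ℕ; zero; suc; _+_; _*_; _∸_; _^_; _%_)
open import Data.Nat.Divisibility using (_∣_)
open import Data.Nat.Primality using (Prime)
open import Data.Bool using (Bool; true; false; _∧_; if_then_else_)
open import Data.List using (List; length)
open import Data.List.Membership.Propositional using (_∈_)
open import Data.List.Relation.Unary.Unique.Propositional using (Unique)
open import Data.Product using (_×_; ∃-syntax)
open import Relation.Binary.PropositionalEquality using (_≡_)
open import Relation.Nullary using (¬_)
open import Function.Bundles using (_⇔_)

repCountUpTo : (ℕ → Bool) → (ℕ → Bool) → ℕ → ℕ → ℕ
repCountUpTo A B n zero    = if A 0 ∧ B n then 1 else 0
repCountUpTo A B n (suc i) =
  (if A (suc i) ∧ B (n ∸ suc i) then 1 else 0) + repCountUpTo A B n i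

repCount : (ℕ → Bool) → (ℕ → Bool) → ℕ → ℕ
repCount A B n = repCountUpTo A B n n

-- B is the reciprocal of A: (Σ_{a∈A} q^a)(Σ_{b∈B} q^b) = 1 in 𝔽₂[[q]],
-- i.e. the coefficient of q^0 is odd and every coefficient of q^n (n > 0) is even.
IsReciprocal : (ℕ → Bool) → (ℕ → Bool) → Set
IsReciprocal A B =
  (repCount A B 0 % 2 ≡ 1) × (∀ n → repCount A B (suc n) % 2 ≡ 0)

IsSquareSet : (ℕ → Bool) → Set
IsSquareSet A = ∀ n → (A n ≡ true) ⇔ (∃[ k ] n ≡ k ^ 2)

IsValuation : ℕ → ℕ → ℕ → Set
IsValuation p n v = (p ^ v ∣ n) × ¬ (p ^ suc v ∣ n)

Special : ℕ → ℕ → Set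
Special n p = Prime p × (p % 4 ≡ 1) × (∃[ v ] (IsValuation p n v × v % 4 ≡ 2))

EvenlyManySpecial : ℕ → Set
EvenlyManySpecial n =
  ∃[ L ] (Unique L × (∀ p → (p ∈ L) ⇔ Special n p) × (length L % 2 ≡ 0))

OneOddPrime : ℕ → Set
OneOddPrime n =
  ∃[ p₀ ] (Prime p₀ × (p₀ % 4 ≡ 1)
           × (∀ v → IsValuation p₀ n v → v % 4 ≡ 1)
           × (∀ p → Prime p → ¬ (p ≡ p₀) → ∀ v → IsValuation p n v → v % 2 ≡ 0))

{-# OPTIONS --safe #-}
module Submission where

-- Over 𝔽₂ we have S(q)² = S(q²), hence S̄(q) = S(q)·S̄(q²). Comparing coefficients gives S̄(2m) = S(m)
-- and, for n ≡ 1 (mod 4), S̄(n) ≡ #{(x, y) : x² + 4y² = n} (mod 2). Zagier's involution of the solutions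
-- of x² + 4yz = n reduces this count modulo 2 to [n is a square] + #{d ∣ n : d² < n} + #{solutions with
-- x + z = y}; the last term vanishes unless n = (2K+1)², when it is K. Finally #{d ∣ n : d² < n} is
-- (τ(n) - [n is a square]) / 2, and the multiplicativity of τ translates its parity into conditions on the
-- exponents ν_p(n); the condition p ≡ 1 (mod 4) in part (2) is forced by n = p · (odd square) ≡ 1 (mod 4).

open import Defs
open import Algebra.Structures using (IsCommutativeMonoid)
open import Data.Nat using (ℕ; zero; suc; _*_; _^_; _%_)
open import Data.Bool using (Bool; true)
open import Data.Product using (_×_; ∃-syntax)
open import Relation.Binary.PropositionalEquality using (_≡_)
open import Relation.Nullary using (¬_)
open import Function.Bundles using (_⇔_)
import Data.Bool.Properties

module Basics where

  open import Data.Nat using (_+_; _∸_; _<_; _≤_; z≤n)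
  open import Data.Nat.Properties
  open import Data.Nat.DivMod using ([m+kn]%n≡m%n; m≡m%n+[m/n]*n; _/_)
  open import Data.Nat.Tactic.RingSolver using (solve-∀)
  open import Data.Bool using (Bool; false; true; if_then_else_; _∧_; _xor_; not)
  open import Data.Bool.Properties using (not-distribˡ-xor)
  open import Data.Product using (_,_)
  open import Data.Sum using (_⊎_; inj₁; inj₂)
  open import Data.Empty using (⊥-elim)
  open import Relation.Binary using (tri<; tri≈; tri>)
  open import Relation.Binary.PropositionalEquality
  open import Relation.Nullary using (Dec; yes; does)
  open import Relation.Nullary.Decidable using (does-≡; map′)

  m+n≡o⇒m≤o : ∀ m n {o} → m + n ≡ o → m ≤ o
  m+n≡o⇒m≤o m n refl = m≤m+n m n

  <-offset : ∀ {m n} → m < n → ∃[ k ] n ≡ m + suc k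
  <-offset {m} {n} m<n = n ∸ suc m , trans (sym (m+[n∸m]≡n m<n)) (sym (+-suc m (n ∸ suc m)))

  ≤-offset : ∀ {m n} → m ≤ n → ∃[ k ] n ≡ m + k
  ≤-offset m≤n = _ , sym (m+[n∸m]≡n m≤n)

  dec-true⁻¹ : ∀ {P : Set} (P? : Dec P) → does P? ≡ true → P
  dec-true⁻¹ (yes p) _ = p

  does-⇔ : ∀ {P Q : Set} → (P → Q) → (Q → P) → (P? : Dec P) (Q? : Dec Q) → does P? ≡ does Q?
  does-⇔ to from P? Q? = does-≡ P? (map′ from to Q?)

  even-or-odd : ∀ n → (∃[ m ] n ≡ 2 * m) ⊎ (∃[ m ] n ≡ suc (2 * m))
  even-or-odd zero    = inj₁ (0 , refl)
  even-or-odd (suc n) with even-or-odd n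
  ... | inj₁ (m , refl) = inj₂ (m , refl)
  ... | inj₂ (m , refl) = inj₁ (suc m , cong suc (sym (+-suc m (m + 0))))

  n≤n*n : ∀ n → n ≤ n * n
  n≤n*n zero    = z≤n
  n≤n*n (suc n) = m≤m*n (suc n) (suc n)

  square-injective : ∀ {a b} → a * a ≡ b * b → a ≡ b
  square-injective {a} {b} a²≡b² with <-cmp a b
  ... | tri< a<b _ _ = ⊥-elim (<-irrefl a²≡b² (*-mono-< a<b a<b))
  ... | tri≈ _ a≡b _ = a≡b
  ... | tri> _ _ b<a = ⊥-elim (<-irrefl (sym a²≡b²) (*-mono-< b<a b<a))

  x²+2[1+2j]≢1+4a : ∀ x j a → x * x + 2 * suc (2 * j) ≢ suc (4 * a)
  x²+2[1+2j]≢1+4a x j a e with even-or-odd x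
  ... | inj₁ (u , refl) = even≢odd (2 * (u * u) + suc (2 * j)) (2 * a) (trans (even-case u j) (trans e (cong suc (*-assoc 2 2 a))))
    where
    even-case : ∀ u j → 2 * (2 * (u * u) + suc (2 * j)) ≡ 2 * u * (2 * u) + 2 * suc (2 * j)
    even-case = solve-∀
  ... | inj₂ (u , refl) = even≢odd a (u * u + u + j)
                            (sym (*-cancelˡ-≡ _ _ 2 (suc-injective (trans (odd-case u j) (trans e (cong suc (*-assoc 2 2 a)))))))
    where
    odd-case : ∀ u j → suc (2 * suc (2 * (u * u + u + j))) ≡ suc (2 * u) * suc (2 * u) + 2 * suc (2 * j)
    odd-case = solve-∀

  odd : ℕ → Bool
  odd zero    = false
  odd (suc n) = not (odd n)

  odd-+ : ∀ m n → odd (m + n) ≡ odd m xor odd n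
  odd-+ zero    n = refl
  odd-+ (suc m) n = trans (cong not (odd-+ m n)) (not-distribˡ-xor (odd m) (odd n))

  odd-* : ∀ m n → odd (m * n) ≡ odd m ∧ odd n
  odd-* zero    n = refl
  odd-* (suc m) n = trans (odd-+ n (m * n)) (trans (cong (odd n xor_) (odd-* m n)) (xor-∧ (odd m) (odd n)))
    where
    xor-∧ : ∀ x y → y xor (x ∧ y) ≡ not x ∧ y
    xor-∧ false y     = Data.Bool.Properties.xor-identityʳ y
    xor-∧ true  false = refl
    xor-∧ true  true  = refl

  odd-2* : ∀ n → odd (2 * n) ≡ false
  odd-2* n = odd-* 2 n

  odd-1+2* : ∀ n → odd (suc (2 * n)) ≡ true
  odd-1+2* n = cong not (odd-2* n)

  odd-if : ∀ b → odd (if b then 1 else 0) ≡ b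
  odd-if true  = refl
  odd-if false = refl

  %2≡if-odd : ∀ n → n % 2 ≡ (if odd n then 1 else 0)
  %2≡if-odd n with even-or-odd n
  ... | inj₁ (m , refl) = trans (trans (cong (_% 2) (*-comm 2 m)) ([m+kn]%n≡m%n 0 m 2))
                                (cong (if_then 1 else 0) (sym (odd-2* m)))
  ... | inj₂ (m , refl) = trans (trans (cong (λ t → suc t % 2) (*-comm 2 m)) ([m+kn]%n≡m%n 1 m 2))
                                (cong (if_then 1 else 0) (sym (odd-1+2* m)))

  %2≡0⇒≡2[/2] : ∀ n → n % 2 ≡ 0 → n ≡ 2 * (n / 2)
  %2≡0⇒≡2[/2] n n%2≡0 = trans (m≡m%n+[m/n]*n n 2) (trans (cong (_+ (n / 2) * 2) n%2≡0) (*-comm (n / 2) 2))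

  %4≡1⇒≡1+4[/4] : ∀ n → n % 4 ≡ 1 → n ≡ suc (4 * (n / 4))
  %4≡1⇒≡1+4[/4] n n%4≡1 = trans (m≡m%n+[m/n]*n n 4) (trans (cong (_+ (n / 4) * 4) n%4≡1) (cong suc (*-comm (n / 4) 4)))

  [1+4n]%4≡1 : ∀ n → suc (4 * n) % 4 ≡ 1
  [1+4n]%4≡1 n = trans (cong (λ t → suc t % 4) (*-comm 4 n)) ([m+kn]%n≡m%n 1 n 4)

  ∧≡true⇒ : ∀ {a b} → a ∧ b ≡ true → a ≡ true × b ≡ true
  ∧≡true⇒ {true} {true} _ = refl , refl

  %2≡1⇒odd : ∀ n → n % 2 ≡ 1 → odd n ≡ true
  %2≡1⇒odd n n%2≡1 with odd n | %2≡if-odd n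
  ... | true  | _ = refl
  ... | false | n%2≡0 with () ← trans (sym n%2≡1) n%2≡0

  %2≡0⇒even : ∀ n → n % 2 ≡ 0 → odd n ≡ false
  %2≡0⇒even n n%2≡0 with odd n | %2≡if-odd n
  ... | false | _ = refl
  ... | true  | n%2≡1 with () ← trans (sym n%2≡0) n%2≡1

  even⇒%2≡0 : ∀ n → odd n ≡ false → n % 2 ≡ 0
  even⇒%2≡0 n even = trans (%2≡if-odd n) (cong (if_then 1 else 0) even)

module FiniteSum {A : Set} {_+_ : A → A → A} {0# : A}
                 (isCommutativeMonoid : IsCommutativeMonoid _≡_ _+_ 0#) where

  open import Data.Nat using (_<_; _≤_; z≤n; s≤s; _∸_) renaming (_+_ to _+ℕ_)
  open import Data.Nat.Properties using (_≟_; _<?_)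
  open import Data.Nat.Properties
    using (m∸n≤m; m+n∸m≡n; m+[n∸m]≡n; m≤m+n; ≤-<-trans; ≤-refl; m<n⇒m<1+n; m≤n⇒m<n∨m≡n; ≤∧≢⇒<; ≤-pred; *-suc; <-irrefl)
  open import Data.Bool using (Bool; true; false; if_then_else_; _∧_)
  open import Data.Product using (_×_; _,_; proj₁; proj₂)
  open import Data.Product.Properties using (≡-dec)
  open import Data.Sum using (inj₁; inj₂)
  open import Relation.Nullary using (¬_; Dec; yes; no; does)
  open import Relation.Nullary.Decidable using (dec-true; dec-false)
  open import Relation.Binary.PropositionalEquality
  open import Algebra.Bundles using (CommutativeSemigroup)
  open IsCommutativeMonoid isCommutativeMonoid using (assoc; comm; identityˡ; identityʳ; isCommutativeSemigroup)

  commutativeSemigroup : CommutativeSemigroup _ _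
  commutativeSemigroup = record { isCommutativeSemigroup = isCommutativeSemigroup }

  open import Algebra.Properties.CommutativeSemigroup commutativeSemigroup using (interchange)
  open import Function using (_∘′_; case_of_)
  open import Relation.Binary.Definitions using (DecidableEquality)
  open ≡-Reasoning

  infixr 7 [_]·_

  [_]·_ : Bool → A → A
  [ b ]· a = if b then a else 0#

  ·-zeroʳ : ∀ b → [ b ]· 0# ≡ 0#
  ·-zeroʳ true  = refl
  ·-zeroʳ false = refl

  ·-∧ : ∀ a b x → [ a ]· [ b ]· x ≡ [ a ∧ b ]· x
  ·-∧ true  b x = refl
  ·-∧ false b x = refl

  ·-yes : ∀ {P : Set} (P? : Dec P) {x} → P → [ does P? ]· x ≡ x
  ·-yes P? p = cong ([_]· _) (dec-true P? p)

  ·-no : ∀ {P : Set} (P? : Dec P) {x} → ¬ P → [ does P? ]· x ≡ 0#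
  ·-no P? ¬p = cong ([_]· _) (dec-false P? ¬p)

  Σ : ℕ → (ℕ → A) → A
  Σ zero    f = 0#
  Σ (suc N) f = Σ N f + f N

  Σ-cong : ∀ N {f g : ℕ → A} → (∀ i → f i ≡ g i) → Σ N f ≡ Σ N g
  Σ-cong zero    f≗g = refl
  Σ-cong (suc N) f≗g = cong₂ _+_ (Σ-cong N f≗g) (f≗g N)

  Σ-cong-< : ∀ N {f g : ℕ → A} → (∀ {i} → i < N → f i ≡ g i) → Σ N f ≡ Σ N g
  Σ-cong-< zero    f≗g = refl
  Σ-cong-< (suc N) f≗g = cong₂ _+_ (Σ-cong-< N (f≗g ∘′ m<n⇒m<1+n)) (f≗g ≤-refl)

  Σ-zero : ∀ N {f : ℕ → A} → (∀ {i} → i < N → f i ≡ 0#) → Σ N f ≡ 0#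
  Σ-zero zero    f≗0 = refl
  Σ-zero (suc N) f≗0 = begin
    Σ N _ + _  ≡⟨ cong₂ _+_ (Σ-zero N (λ i<N → f≗0 (m<n⇒m<1+n i<N))) (f≗0 ≤-refl) ⟩
    0# + 0#    ≡⟨ identityˡ 0# ⟩
    0#         ∎

  Σ-distrib : ∀ N (f g : ℕ → A) → Σ N (λ i → f i + g i) ≡ Σ N f + Σ N g
  Σ-distrib zero    f g = sym (identityˡ 0#)
  Σ-distrib (suc N) f g = trans (cong (_+ (f N + g N)) (Σ-distrib N f g)) (interchange _ _ _ _)

  Σ-[]· : ∀ N b (f : ℕ → A) → Σ N (λ i → [ b ]· f i) ≡ [ b ]· Σ N f
  Σ-[]· N true  f = refl
  Σ-[]· N false f = Σ-zero N (λ _ → refl)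

  Σ-extend : ∀ {N M} {f : ℕ → A} → N ≤ M → (∀ {i} → N ≤ i → i < M → f i ≡ 0#) → Σ M f ≡ Σ N f
  Σ-extend {zero} {zero} z≤n f≗0 = refl
  Σ-extend {N} {suc M} {f} N≤M f≗0 with m≤n⇒m<n∨m≡n N≤M
  ... | inj₂ refl      = refl
  ... | inj₁ (s≤s N≤M′) = begin
    Σ M f + f M  ≡⟨ cong₂ _+_ (Σ-extend N≤M′ (λ N≤i i<M → f≗0 N≤i (m<n⇒m<1+n i<M))) (f≗0 N≤M′ ≤-refl) ⟩
    Σ N f + 0#   ≡⟨ identityʳ _ ⟩
    Σ N f        ∎

  Σ-swap : ∀ N M (f : ℕ → ℕ → A) → Σ N (λ i → Σ M (f i)) ≡ Σ M (λ j → Σ N (λ i → f i j))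
  Σ-swap zero    M f = sym (Σ-zero M (λ _ → refl))
  Σ-swap (suc N) M f = begin
    Σ N (λ i → Σ M (f i)) + Σ M (f N)          ≡⟨ cong (_+ Σ M (f N)) (Σ-swap N M f) ⟩
    Σ M (λ j → Σ N (λ i → f i j)) + Σ M (f N)  ≡⟨ Σ-distrib M _ _ ⟨
    Σ M (λ j → Σ N (λ i → f i j) + f N j)      ∎

  Σ-head : ∀ N (f : ℕ → A) → Σ (suc N) f ≡ f 0 + Σ N (λ i → f (suc i))
  Σ-head zero    f = trans (identityˡ _) (sym (identityʳ _))
  Σ-head (suc N) f = trans (cong (_+ f (suc N)) (Σ-head N f)) (assoc _ _ _)

  Σ-single : ∀ N a {f : ℕ → A} → a < N → (∀ {i} → i < N → i ≢ a → f i ≡ 0#) → Σ N f ≡ f a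
  Σ-single (suc N) a {f} a<1+N f≗0 with a ≟ N
  ... | yes refl = begin
    Σ N f + f a  ≡⟨ cong (_+ f a) (Σ-zero N (λ i<N → f≗0 (m<n⇒m<1+n i<N) (λ { refl → <-irrefl refl i<N }))) ⟩
    0# + f a     ≡⟨ identityˡ _ ⟩
    f a          ∎
  ... | no a≢N = begin
    Σ N f + f N  ≡⟨ cong₂ _+_ (Σ-single N a (≤∧≢⇒< (≤-pred a<1+N) a≢N) (f≗0 ∘′ m<n⇒m<1+n)) (f≗0 ≤-refl (a≢N ∘′ sym)) ⟩
    f a + 0#     ≡⟨ identityʳ _ ⟩
    f a          ∎

  Σ-delta : ∀ N a (g : ℕ → A) → Σ N (λ i → [ does (a ≟ i) ]· g i) ≡ [ does (a <? N) ]· g a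
  Σ-delta N a g with a <? N
  ... | yes a<N = begin
    Σ N (λ i → [ does (a ≟ i) ]· g i)  ≡⟨ Σ-single N a a<N (λ _ i≢a → ·-no (a ≟ _) (i≢a ∘′ sym)) ⟩
    [ does (a ≟ a) ]· g a              ≡⟨ ·-yes (a ≟ a) refl ⟩
    g a                                ≡⟨ ·-yes (a <? N) a<N ⟨
    [ does (a <? N) ]· g a             ∎
  ... | no  a≮N = begin
    Σ N (λ i → [ does (a ≟ i) ]· g i)  ≡⟨ Σ-zero N (λ i<N → ·-no (a ≟ _) (λ { refl → a≮N i<N })) ⟩
    0#                                 ≡⟨ ·-no (a <? N) a≮N ⟨
    [ does (a <? N) ]· g a             ∎

  Σ-shifted-delta : ∀ N a m (x : ℕ → A) {Q : ℕ → Set} (Q? : ∀ j → Dec (Q j)) →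
                    (∀ j → Q j → a +ℕ j ≡ m) → (∀ j → a +ℕ j ≡ m → Q j) → m < N →
                    Σ N (λ j → [ does (Q? j) ]· x j) ≡ [ does (a <? suc m) ]· x (m ∸ a)
  Σ-shifted-delta N a m x Q? to from m<N with a <? suc m
  ... | yes a≤m = begin
      Σ N (λ j → [ does (Q? j) ]· x j)  ≡⟨ Σ-single N (m ∸ a) (≤-<-trans (m∸n≤m m a) m<N) (off-solution _) ⟩
      [ does (Q? (m ∸ a)) ]· x (m ∸ a)  ≡⟨ ·-yes (Q? (m ∸ a)) (from (m ∸ a) (m+[n∸m]≡n (≤-pred a≤m))) ⟩
      x (m ∸ a)                         ≡⟨ ·-yes (a <? suc m) a≤m ⟨
      [ does (a <? suc m) ]· x (m ∸ a)  ∎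
      where
      off-solution : ∀ j → j < N → j ≢ m ∸ a → [ does (Q? j) ]· x j ≡ 0#
      off-solution j _ j≢ = ·-no (Q? j) (λ q → j≢ (trans (sym (m+n∸m≡n a j)) (cong (_∸ a) (to j q))))
  ... | no a>m = begin
      Σ N (λ j → [ does (Q? j) ]· x j)
        ≡⟨ Σ-zero N (λ {j} _ → ·-no (Q? j) (λ q → a>m (s≤s (subst (a ≤_) (to j q) (m≤m+n a j))))) ⟩
      0#                                ≡⟨ ·-no (a <? suc m) a>m ⟨
      [ does (a <? suc m) ]· x (m ∸ a)  ∎

  Σ-even-odd : ∀ N (f : ℕ → A) → Σ (2 * N) f ≡ Σ N (λ i → f (2 * i)) + Σ N (λ i → f (suc (2 * i)))
  Σ-even-odd zero    f = sym (identityˡ 0#)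
  Σ-even-odd (suc N) f = begin
    Σ (2 * suc N) f                         ≡⟨ cong (λ t → Σ t f) (*-suc 2 N) ⟩
    (Σ (2 * N) f + f (2 * N)) + f (suc (2 * N))
      ≡⟨ cong (λ t → (t + f (2 * N)) + f (suc (2 * N))) (Σ-even-odd N f) ⟩
    ((E + O) + f (2 * N)) + f (suc (2 * N))  ≡⟨ cong (_+ f (suc (2 * N))) (assoc E O _) ⟩
    (E + (O + f (2 * N))) + f (suc (2 * N))  ≡⟨ cong (λ t → (E + t) + f (suc (2 * N))) (comm O _) ⟩
    (E + (f (2 * N) + O)) + f (suc (2 * N))  ≡⟨ cong (_+ f (suc (2 * N))) (assoc E _ O) ⟨
    ((E + f (2 * N)) + O) + f (suc (2 * N))  ≡⟨ assoc _ O _ ⟩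
    (E + f (2 * N)) + (O + f (suc (2 * N)))  ∎
    where
    E = Σ N (λ i → f (2 * i))
    O = Σ N (λ i → f (suc (2 * i)))

  ℕ³ : Set
  ℕ³ = ℕ × ℕ × ℕ

  Σ³ : ℕ → (ℕ³ → A) → A
  Σ³ N f = Σ N (λ x → Σ N (λ y → Σ N (λ z → f (x , y , z))))

  InBox : ℕ → ℕ³ → Set
  InBox N (x , y , z) = x < N × y < N × z < N

  Σ³-cong : ∀ N {f g : ℕ³ → A} → (∀ p → f p ≡ g p) → Σ³ N f ≡ Σ³ N g
  Σ³-cong N f≗g = Σ-cong N (λ x → Σ-cong N (λ y → Σ-cong N (λ z → f≗g (x , y , z))))

  Σ³-zero : ∀ N {f : ℕ³ → A} → (∀ p → f p ≡ 0#) → Σ³ N f ≡ 0#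
  Σ³-zero N f≗0 = Σ-zero N (λ _ → Σ-zero N (λ _ → Σ-zero N (λ _ → f≗0 _)))

  Σ³-distrib : ∀ N (f g : ℕ³ → A) → Σ³ N (λ p → f p + g p) ≡ Σ³ N f + Σ³ N g
  Σ³-distrib N f g = trans (Σ-cong N (λ x → trans (Σ-cong N (λ y → Σ-distrib N _ _)) (Σ-distrib N _ _)))
                           (Σ-distrib N _ _)

  Σ³-single : ∀ N a {f : ℕ³ → A} → InBox N a → (∀ p → p ≢ a → f p ≡ 0#) → Σ³ N f ≡ f a
  Σ³-single N (a , b , c) (a<N , b<N , c<N) f≗0 =
    trans (Σ-single N a a<N (λ _ x≢a → Σ-zero N (λ _ → Σ-zero N (λ _ → f≗0 _ (x≢a ∘′ cong proj₁)))))
    (trans (Σ-single N b b<N (λ _ y≢b → Σ-zero N (λ _ → f≗0 _ (y≢b ∘′ cong (proj₁ ∘′ proj₂)))))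
           (Σ-single N c c<N (λ _ z≢c → f≗0 _ (z≢c ∘′ cong (proj₂ ∘′ proj₂)))))

  Σ³-swap : ∀ N (h : ℕ³ → ℕ³ → A) → Σ³ N (λ p → Σ³ N (h p)) ≡ Σ³ N (λ q → Σ³ N (λ p → h p q))
  Σ³-swap N h = trans (Σ-cong N (λ x → trans (Σ-cong N (λ y → pull _)) (pull _))) (pull _)
    where
    pull : ∀ (k : ℕ → ℕ³ → A) → Σ N (λ i → Σ³ N (k i)) ≡ Σ³ N (λ q → Σ N (λ i → k i q))
    pull k = trans (Σ-swap N N _) (Σ-cong N (λ x → trans (Σ-swap N N _) (Σ-cong N (λ y → Σ-swap N N _))))

  module Reindexing {I : Set} (_≟ᵢ_ : DecidableEquality I) (InRange : I → Set)
    (ΣI : (I → A) → A)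
    (ΣI-cong : ∀ {f g : I → A} → (∀ i → f i ≡ g i) → ΣI f ≡ ΣI g)
    (ΣI-zero : ∀ {f : I → A} → (∀ i → f i ≡ 0#) → ΣI f ≡ 0#)
    (ΣI-single : ∀ a {f : I → A} → InRange a → (∀ i → i ≢ a → f i ≡ 0#) → ΣI f ≡ f a)
    (ΣI-swap : ∀ (h : I → I → A) → ΣI (λ i → ΣI (h i)) ≡ ΣI (λ j → ΣI (λ i → h i j)))
    where

    reindex : ∀ (g : I → Bool) (σ : I → I) (φ : I → A) →
              (∀ i → g i ≡ true → InRange i) →
              (∀ i → g i ≡ true → g (σ i) ≡ true × σ (σ i) ≡ i) →
              ΣI (λ i → [ g i ]· φ (σ i)) ≡ ΣI (λ i → [ g i ]· φ i)
    reindex g σ φ inRange invol = begin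
      ΣI (λ i → [ g i ]· φ (σ i))                          ≡⟨ ΣI-cong spread ⟩
      ΣI (λ i → ΣI (λ j → [ g i ]· [ does (j ≟ᵢ σ i) ]· φ j))  ≡⟨ ΣI-swap _ ⟩
      ΣI (λ j → ΣI (λ i → [ g i ]· [ does (j ≟ᵢ σ i) ]· φ j))  ≡⟨ ΣI-cong collect ⟩
      ΣI (λ j → [ g j ]· φ j)                              ∎
      where
      delta : ∀ a → InRange a → ΣI (λ j → [ does (j ≟ᵢ a) ]· φ j) ≡ φ a
      delta a a∈ = trans (ΣI-single a a∈ (λ j j≢a → ·-no (j ≟ᵢ a) j≢a)) (·-yes (a ≟ᵢ a) refl)

      spread : ∀ i → [ g i ]· φ (σ i) ≡ ΣI (λ j → [ g i ]· [ does (j ≟ᵢ σ i) ]· φ j)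
      spread i with g i in gi
      ... | false = sym (ΣI-zero (λ _ → refl))
      ... | true  = sym (delta (σ i) (inRange (σ i) (proj₁ (invol i gi))))

      unhit : ∀ {i j} → g j ≡ false → [ g i ]· [ does (j ≟ᵢ σ i) ]· φ j ≡ 0#
      unhit {i} {j} gj with g i in gi
      ... | false = refl
      ... | true  = ·-no (j ≟ᵢ σ i) (λ { refl → case trans (sym gj) (proj₁ (invol i gi)) of λ () })

      collect : ∀ j → ΣI (λ i → [ g i ]· [ does (j ≟ᵢ σ i) ]· φ j) ≡ [ g j ]· φ j
      collect j with g j in gj
      ... | false = ΣI-zero (λ i → unhit gj)
      ... | true  = begin
        ΣI (λ i → [ g i ]· [ does (j ≟ᵢ σ i) ]· φ j)  ≡⟨ ΣI-single (σ j) (inRange (σ j) gσj) others ⟩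
        [ g (σ j) ]· [ does (j ≟ᵢ σ (σ j)) ]· φ j     ≡⟨ cong (λ b → [ b ]· [ does (j ≟ᵢ σ (σ j)) ]· φ j) gσj ⟩
        [ does (j ≟ᵢ σ (σ j)) ]· φ j                  ≡⟨ ·-yes (j ≟ᵢ σ (σ j)) (sym (proj₂ (invol j gj))) ⟩
        φ j                                          ∎
        where
        gσj = proj₁ (invol j gj)
        others : ∀ i → i ≢ σ j → [ g i ]· [ does (j ≟ᵢ σ i) ]· φ j ≡ 0#
        others i i≢σj with g i in gi
        ... | false = refl
        ... | true  = ·-no (j ≟ᵢ σ i) (λ { refl → i≢σj (sym (proj₂ (invol i gi))) })

  Σ-reindex : ∀ N (g : ℕ → Bool) (σ : ℕ → ℕ) (φ : ℕ → A) →
              (∀ i → g i ≡ true → i < N) →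
              (∀ i → g i ≡ true → g (σ i) ≡ true × σ (σ i) ≡ i) →
              Σ N (λ i → [ g i ]· φ (σ i)) ≡ Σ N (λ i → [ g i ]· φ i)
  Σ-reindex N = Reindexing.reindex _≟_ (_< N) (Σ N) (Σ-cong N) (λ f≗0 → Σ-zero N (λ _ → f≗0 _))
                  (λ a a<N f≗0 → Σ-single N a a<N (λ _ → f≗0 _)) (Σ-swap N N)

  Σ³-reindex : ∀ N (g : ℕ³ → Bool) (σ : ℕ³ → ℕ³) (φ : ℕ³ → A) →
               (∀ p → g p ≡ true → InBox N p) →
               (∀ p → g p ≡ true → g (σ p) ≡ true × σ (σ p) ≡ p) →
               Σ³ N (λ p → [ g p ]· φ (σ p)) ≡ Σ³ N (λ p → [ g p ]· φ p)
  Σ³-reindex N = Reindexing.reindex (≡-dec _≟_ (≡-dec _≟_ _≟_)) (InBox N) (Σ³ N) (Σ³-cong N) (Σ³-zero N)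
                   (Σ³-single N) (Σ³-swap N)

module ParitySum where

  open import Algebra.Bundles using (CommutativeRing)
  open import Data.Nat.Properties using (_≟_; _<?_; <-cmp; <-strictTotalOrder)
  open import Data.Bool using (Bool; true; false; _∧_; _xor_; not)
  open import Data.Bool.Properties using (xor-∧-commutativeRing; xor-identityʳ; xor-same; ∧-comm)
  open import Data.Product using (_×_; _,_; proj₂)
  open import Data.Product.Properties using (≡-dec)
  open import Data.Product.Relation.Binary.Lex.Strict using (×-strictTotalOrder)
  open import Data.Empty using (⊥-elim)
  open import Relation.Binary using (StrictTotalOrder; tri<; tri≈; tri>)
  open import Relation.Nullary using (Dec; yes; no; does)
  open import Relation.Nullary.Decidable using (dec-true; dec-false)
  open import Relation.Binary.PropositionalEquality
  open import Function using (_∘′_; case_of_)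
  open Basics using (does-⇔)
  open ≡-Reasoning

  open FiniteSum (CommutativeRing.+-isCommutativeMonoid xor-∧-commutativeRing) public

  ·≡∧ : ∀ b x → [ b ]· x ≡ b ∧ x
  ·≡∧ true  x = refl
  ·≡∧ false x = refl

  ∧≡· : ∀ a b → a ∧ b ≡ [ b ]· a
  ∧≡· a b = trans (∧-comm a b) (sym (·≡∧ b a))

  ·-comm : ∀ a b → [ a ]· b ≡ [ b ]· a
  ·-comm false false = refl
  ·-comm false true  = refl
  ·-comm true  false = refl
  ·-comm true  true  = refl

  Σ-·ˡ : ∀ N (c : ℕ → Bool) x → Σ N (λ i → [ c i ]· x) ≡ [ Σ N c ]· x
  Σ-·ˡ zero    c x = refl
  Σ-·ˡ (suc N) c x = trans (cong (_xor [ c N ]· x) (Σ-·ˡ N c x)) (·-distrib-xor (Σ N c) (c N))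
    where
    ·-distrib-xor : ∀ a b → [ a ]· x xor [ b ]· x ≡ [ a xor b ]· x
    ·-distrib-xor false b     = refl
    ·-distrib-xor true  false = xor-identityʳ x
    ·-distrib-xor true  true  = xor-same x

  Σ-symmetric : ∀ N (h : ℕ → ℕ → Bool) → (∀ k l → h k l ≡ h l k) →
                Σ N (λ k → Σ N (h k)) ≡ Σ N (λ k → h k k)
  Σ-symmetric N h h-sym = begin
    Σ N (λ k → Σ N (h k))                              ≡⟨ Σ-cong N (λ k → Σ-cong N (split k)) ⟩
    Σ N (λ k → Σ N (λ l → Lo k l xor (Eq k l xor Hi k l)))
      ≡⟨ Σ-cong N (λ k → trans (Σ-distrib N _ _) (cong (Σ N (Lo k) xor_) (Σ-distrib N _ _))) ⟩
    Σ N (λ k → Σ N (Lo k) xor (Σ N (Eq k) xor Σ N (Hi k)))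
      ≡⟨ trans (Σ-distrib N _ _) (cong (ΣLo xor_) (Σ-distrib N _ _)) ⟩
    ΣLo xor (ΣEq xor ΣHi)                              ≡⟨ cong (λ t → ΣLo xor (ΣEq xor t)) Hi≡Lo ⟩
    ΣLo xor (ΣEq xor ΣLo)                              ≡⟨ cancel ΣLo ΣEq ⟩
    ΣEq                                                ≡⟨ Σ-cong N (λ k → Σ-delta N k (h k)) ⟩
    Σ N (λ k → [ does (k <? N) ]· h k k)              ≡⟨ Σ-cong-< N (λ k<N → ·-yes (_ <? N) k<N) ⟩
    Σ N (λ k → h k k)                                  ∎
    where
    Lo Eq Hi : ℕ → ℕ → Bool
    Lo k l = [ does (k <? l) ]· h k l
    Eq k l = [ does (k ≟ l) ]· h k l
    Hi k l = [ does (l <? k) ]· h k l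
    ΣLo = Σ N (λ k → Σ N (Lo k))
    ΣEq = Σ N (λ k → Σ N (Eq k))
    ΣHi = Σ N (λ k → Σ N (Hi k))

    split : ∀ k l → h k l ≡ Lo k l xor (Eq k l xor Hi k l)
    split k l with <-cmp k l
    ... | tri< k<l k≢l l≮k rewrite dec-true (k <? l) k<l | dec-false (k ≟ l) k≢l | dec-false (l <? k) l≮k
        = sym (xor-identityʳ _)
    ... | tri≈ k≮l k≡l l≮k rewrite dec-false (k <? l) k≮l | dec-true (k ≟ l) k≡l | dec-false (l <? k) l≮k
        = sym (xor-identityʳ _)
    ... | tri> k≮l k≢l l<k rewrite dec-false (k <? l) k≮l | dec-false (k ≟ l) k≢l | dec-true (l <? k) l<k
        = refl

    Hi≡Lo : ΣHi ≡ ΣLo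
    Hi≡Lo = trans (Σ-swap N N Hi) (Σ-cong N (λ k → Σ-cong N (λ l → cong ([ does (k <? l) ]·_) (h-sym l k))))

    cancel : ∀ a b → a xor (b xor a) ≡ b
    cancel false b     = xor-identityʳ b
    cancel true  false = refl
    cancel true  true  = refl

  _≟³_ : (p q : ℕ³) → Dec (p ≡ q)
  _≟³_ = ≡-dec _≟_ (≡-dec _≟_ _≟_)

  does-≟³-sym : ∀ p q → does (p ≟³ q) ≡ does (q ≟³ p)
  does-≟³-sym p q = does-⇔ sym sym (p ≟³ q) (q ≟³ p)

  open StrictTotalOrder (×-strictTotalOrder <-strictTotalOrder (×-strictTotalOrder <-strictTotalOrder <-strictTotalOrder))
    using (compare) renaming (_<?_ to _<³?_)

  <³-one-way : ∀ p q → p ≢ q → does (p <³? q) xor does (q <³? p) ≡ true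
  <³-one-way p q p≢q = case compare p q of λ where
    (tri< p<q _ q≮p)               → cong₂ _xor_ (dec-true (p <³? q) p<q) (dec-false (q <³? p) q≮p)
    (tri≈ _ (refl , refl , refl) _) → ⊥-elim (p≢q refl)
    (tri> p≮q _ q<p)               → cong₂ _xor_ (dec-false (p <³? q) p≮q) (dec-true (q <³? p) q<p)

  -- Σ g splits into the fixed points of σ and the moved points p with p < σ p resp. σ p < p; σ matches the
  -- last two sets with each other, so their contributions cancel over 𝔽₂.
  Σ³-fixed-points : ∀ N (g : ℕ³ → Bool) (σ : ℕ³ → ℕ³) →
                    (∀ p → g p ≡ true → InBox N p) →
                    (∀ p → g p ≡ true → g (σ p) ≡ true × σ (σ p) ≡ p) →
                    Σ³ N g ≡ Σ³ N (λ p → g p ∧ does (σ p ≟³ p))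
  Σ³-fixed-points N g σ inBox invol = begin
    Σ³ N g                                    ≡⟨ Σ³-cong N split ⟩
    Σ³ N (λ p → Fix p xor (Up p xor Down p))
      ≡⟨ trans (Σ³-distrib N _ _) (cong (Σ³ N Fix xor_) (Σ³-distrib N _ _)) ⟩
    Σ³ N Fix xor (Σ³ N Up xor Σ³ N Down)      ≡⟨ cong (λ t → Σ³ N Fix xor (Σ³ N Up xor t)) Down≡Up ⟩
    Σ³ N Fix xor (Σ³ N Up xor Σ³ N Up)        ≡⟨ cong (Σ³ N Fix xor_) (xor-same (Σ³ N Up)) ⟩
    Σ³ N Fix xor false                        ≡⟨ xor-identityʳ _ ⟩
    Σ³ N Fix                                  ∎
    where
    moved : ℕ³ → Bool
    moved p = not (does (σ p ≟³ p))

    Fix Up Down : ℕ³ → Bool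
    Fix  p = g p ∧ does (σ p ≟³ p)
    Up   p = g p ∧ (moved p ∧ does (p <³? σ p))
    Down p = g p ∧ (moved p ∧ does (σ p <³? p))

    split : ∀ p → g p ≡ Fix p xor (Up p xor Down p)
    split p with g p | σ p ≟³ p
    ... | false | _        = refl
    ... | true  | yes _    = refl
    ... | true  | no  σp≢p = sym (<³-one-way p (σ p) (σp≢p ∘′ sym))

    up : ℕ³ → Bool
    up q = moved q ∧ does (q <³? σ q)

    Down-via-σ : ∀ p → Down p ≡ [ g p ]· up (σ p)
    Down-via-σ p with g p in gp
    ... | false = refl
    ... | true rewrite proj₂ (invol p gp) = cong (λ b → not b ∧ does (σ p <³? p)) (does-≟³-sym (σ p) p)

    Down≡Up : Σ³ N Down ≡ Σ³ N Up
    Down≡Up = begin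
      Σ³ N Down                      ≡⟨ Σ³-cong N Down-via-σ ⟩
      Σ³ N (λ p → [ g p ]· up (σ p))  ≡⟨ Σ³-reindex N g σ up inBox invol ⟩
      Σ³ N (λ p → [ g p ]· up p)      ≡⟨ Σ³-cong N (λ p → ·≡∧ (g p) (up p)) ⟩
      Σ³ N Up                        ∎

module Reciprocals where

  open import Algebra.Bundles using (CommutativeRing)
  open import Data.Bool.Properties using (xor-∧-commutativeRing)
  open import Algebra.Properties.Group (CommutativeRing.+-group xor-∧-commutativeRing) using (∙-cancelʳ)
  open import Data.Nat using (_+_; _∸_; _<_; _≤_; z<s)
  open import Data.Nat.Properties
  open import Data.Nat.Induction using (<-rec)
  open import Data.Bool using (_∧_; _xor_; if_then_else_)
  import Data.Bool.Properties
  open import Data.Product using (_,_)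
  open import Relation.Nullary using (yes; no; does)
  open import Relation.Binary.PropositionalEquality
  open Basics
  open ParitySum
  open ≡-Reasoning

  repCount-parity : ∀ A C n i → odd (repCountUpTo A C n i) ≡ Σ (suc i) (λ j → A j ∧ C (n ∸ j))
  repCount-parity A C n zero    = odd-if (A 0 ∧ C n)
  repCount-parity A C n (suc i) = begin
    odd ((if A (suc i) ∧ C (n ∸ suc i) then 1 else 0) + repCountUpTo A C n i)
      ≡⟨ odd-+ (if A (suc i) ∧ C (n ∸ suc i) then 1 else 0) _ ⟩
    odd (if A (suc i) ∧ C (n ∸ suc i) then 1 else 0) xor odd (repCountUpTo A C n i)
      ≡⟨ cong₂ _xor_ (odd-if (A (suc i) ∧ C (n ∸ suc i))) (repCount-parity A C n i) ⟩
    (A (suc i) ∧ C (n ∸ suc i)) xor Σ (suc i) (λ j → A j ∧ C (n ∸ j))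
      ≡⟨ Data.Bool.Properties.xor-comm (A (suc i) ∧ C (n ∸ suc i)) _ ⟩
    Σ (suc (suc i)) (λ j → A j ∧ C (n ∸ j))  ∎

  reciprocal-convolution : ∀ {A C} → IsReciprocal A C → ∀ n → Σ (suc n) (λ j → A j ∧ C (n ∸ j)) ≡ does (n ≟ 0)
  reciprocal-convolution {A} {C} (constant , vanishing) zero    =
    trans (sym (repCount-parity A C 0 0)) (%2≡1⇒odd (repCount A C 0) constant)
  reciprocal-convolution {A} {C} (constant , vanishing) (suc n) =
    trans (sym (repCount-parity A C (suc n) (suc n))) (%2≡0⇒even (repCount A C (suc n)) (vanishing n))

  IsSquareReciprocal : (ℕ → Bool) → Set
  IsSquareReciprocal X = ∀ n → Σ (suc n) (λ k → [ does (k * k <? suc n) ]· X (n ∸ k * k)) ≡ does (n ≟ 0)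

  squareReciprocal-unique : ∀ {X Y} → IsSquareReciprocal X → IsSquareReciprocal Y → ∀ n → X n ≡ Y n
  squareReciprocal-unique {X} {Y} X-rec Y-rec = <-rec _ step
    where
    later : (ℕ → Bool) → ℕ → ℕ → Bool
    later Z n k = [ does (suc k * suc k <? suc n) ]· Z (n ∸ suc k * suc k)

    step : ∀ n → (∀ {m} → m < n → X m ≡ Y m) → X n ≡ Y n
    step n IH = ∙-cancelʳ (Σ n (later X n)) (X n) (Y n) (begin
      X n xor Σ n (later X n)  ≡⟨ Σ-head n _ ⟨
      Σ (suc n) _              ≡⟨ X-rec n ⟩
      does (n ≟ 0)             ≡⟨ Y-rec n ⟨
      Σ (suc n) _              ≡⟨ Σ-head n _ ⟩
      Y n xor Σ n (later Y n)  ≡⟨ cong (Y n xor_) (Σ-cong n same-later) ⟨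
      Y n xor Σ n (later X n)  ∎)
      where
      same-later : ∀ k → later X n k ≡ later Y n k
      same-later k with suc k * suc k <? suc n
      ... | yes k²≤n = cong ([ _ ]·_) (IH (∸-monoʳ-< z<s (≤-pred k²≤n)))
      ... | no  k²>n = trans (·-no (suc k * suc k <? suc n) k²>n) (sym (·-no (suc k * suc k <? suc n) k²>n))

-- Bool-valued sums are sums in 𝔽₂, so #… is the parity of a count.
#x²+4y² : ℕ → Bool
#x²+4y² n = ParitySum.Σ (suc n) (λ x → ParitySum.Σ (suc n) (λ y → does (x * x + 4 * (y * y) ≟ n)))
  where
  open import Data.Nat using (_+_)
  open import Data.Nat.Properties using (_≟_)
  open import Relation.Nullary using (does)

module ReciprocalOfSquares (S S̄ : ℕ → Bool) (S-squares : IsSquareSet S) (S̄-reciprocal : IsReciprocal S S̄) where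

  open import Data.Nat using (_+_; _∸_; _<_; _≤_; s≤s)
  open import Data.Nat.Properties
  open import Data.Nat.Tactic.RingSolver using (solve-∀)
  open import Data.Bool using (false; _∧_; _xor_)
  open import Data.Bool.Properties using (xor-identityʳ)
  open import Data.Product using (_,_)
  open import Data.Sum using (inj₁; inj₂)
  open import Relation.Nullary using (yes; no; does; _×-dec_)
  open import Relation.Nullary.Decidable using (dec-false)
  open import Relation.Binary.PropositionalEquality
  open import Function using (_∘′_; case_of_)
  open import Function.Bundles using (Equivalence)
  open Basics
  open ParitySum
  open Reciprocals
  open ≡-Reasoning


  S-square : ∀ k → S (k * k) ≡ true
  S-square k = Equivalence.from (S-squares (k * k)) (k , cong (k *_) (sym (*-identityʳ k)))

  S⇒square : ∀ {i} → S i ≡ true → ∃[ k ] i ≡ k * k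
  S⇒square {i} Si with Equivalence.to (S-squares i) Si
  ... | k , i≡k² = k , trans i≡k² (cong (k *_) (*-identityʳ k))

  Σ-squares : ∀ N (g : ℕ → Bool) → Σ N (λ i → [ S i ]· g i) ≡ Σ N (λ k → [ does (k * k <? N) ]· g (k * k))
  Σ-squares N g = begin
    Σ N (λ i → [ S i ]· g i)                           ≡⟨ Σ-cong-< N root ⟩
    Σ N (λ i → Σ N (λ k → [ does (k * k ≟ i) ]· g i))  ≡⟨ Σ-swap N N _ ⟩
    Σ N (λ k → Σ N (λ i → [ does (k * k ≟ i) ]· g i))  ≡⟨ Σ-cong N (λ k → Σ-delta N (k * k) g) ⟩
    Σ N (λ k → [ does (k * k <? N) ]· g (k * k))       ∎
    where
    root : ∀ {i} → i < N → [ S i ]· g i ≡ Σ N (λ k → [ does (k * k ≟ i) ]· g i)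
    root {i} i<N with S i in Si
    ... | false = sym (Σ-zero N (λ {k} _ → ·-no (k * k ≟ i) (λ { refl → case trans (sym Si) (S-square k) of λ () })))
    ... | true with S⇒square Si
    ...   | k , refl = sym (begin
      Σ N (λ l → [ does (l * l ≟ k * k) ]· g (k * k))
        ≡⟨ Σ-single N k (≤-<-trans (n≤n*n k) i<N) (λ _ l≢k → ·-no (_ ≟ k * k) (l≢k ∘′ square-injective)) ⟩
      [ does (k * k ≟ k * k) ]· g (k * k)
        ≡⟨ ·-yes (k * k ≟ k * k) refl ⟩
      g (k * k)  ∎)

  S̄-isSquareReciprocal : IsSquareReciprocal S̄
  S̄-isSquareReciprocal n = begin
    Σ (suc n) (λ k → [ does (k * k <? suc n) ]· S̄ (n ∸ k * k))  ≡⟨ Σ-squares (suc n) (λ i → S̄ (n ∸ i)) ⟨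
    Σ (suc n) (λ i → [ S i ]· S̄ (n ∸ i))                        ≡⟨ Σ-cong (suc n) (λ i → ·≡∧ (S i) _) ⟩
    Σ (suc n) (λ i → S i ∧ S̄ (n ∸ i))                           ≡⟨ reciprocal-convolution {S} {S̄} S̄-reciprocal n ⟩
    does (n ≟ 0)                                                ∎

  -- Coefficients of S(q)·S̄(q²), which is again reciprocal to S because S(q)² = S(q²) over 𝔽₂.
  D : ℕ → Bool
  D t = Σ (suc t) (λ l → Σ (suc t) (λ j → [ does (l * l + 2 * j ≟ t) ]· S̄ j))

  D-shift : ∀ n k → [ does (k * k <? suc n) ]· D (n ∸ k * k)
                  ≡ Σ (suc n) (λ l → Σ (suc n) (λ j → [ does (k * k + (l * l + 2 * j) ≟ n) ]· S̄ j))
  D-shift n k with k * k <? suc n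
  ... | no k²>n = trans (·-no (k * k <? suc n) k²>n)
      (sym (Σ-zero (suc n) (λ _ → Σ-zero (suc n) (λ _ → ·-no (_ ≟ n) (λ e → k²>n (s≤s (subst (k * k ≤_) e (m≤m+n _ _))))))))
  ... | yes k²<1+n = begin
    [ does (k * k <? suc n) ]· D t
      ≡⟨ ·-yes (k * k <? suc n) k²<1+n ⟩
    D t
      ≡⟨ Σ-cong (suc t) (λ l → Σ-cong (suc t) (λ j → cong ([_]· S̄ j) (does-⇔ add sub (_ ≟ t) (_ ≟ n)))) ⟩
    Σ (suc t) (λ l → Σ (suc t) (λ j → [ does (k * k + (l * l + 2 * j) ≟ n) ]· S̄ j))
      ≡⟨ restrict ⟨
    Σ (suc n) (λ l → Σ (suc n) (λ j → [ does (k * k + (l * l + 2 * j) ≟ n) ]· S̄ j))  ∎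
    where
    t = n ∸ k * k
    k²≤n = ≤-pred k²<1+n

    add : ∀ {s} → s ≡ t → k * k + s ≡ n
    add s≡t = trans (cong (k * k +_) s≡t) (m+[n∸m]≡n k²≤n)

    sub : ∀ {s} → k * k + s ≡ n → s ≡ t
    sub e = trans (sym (m+n∸m≡n (k * k) _)) (cong (_∸ k * k) e)

    l-bound : ∀ {l j} → k * k + (l * l + 2 * j) ≡ n → l ≤ t
    l-bound {l} {j} e = subst (l ≤_) (sub {l * l + 2 * j} e) (≤-trans (n≤n*n l) (m≤m+n (l * l) (2 * j)))

    j-bound : ∀ {l j} → k * k + (l * l + 2 * j) ≡ n → j ≤ t
    j-bound {l} {j} e = subst (j ≤_) (sub {l * l + 2 * j} e) (≤-trans (m≤n*m j 2) (m≤n+m (2 * j) (l * l)))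

    restrict : Σ (suc n) (λ l → Σ (suc n) (λ j → [ does (k * k + (l * l + 2 * j) ≟ n) ]· S̄ j))
             ≡ Σ (suc t) (λ l → Σ (suc t) (λ j → [ does (k * k + (l * l + 2 * j) ≟ n) ]· S̄ j))
    restrict = trans
      (Σ-cong (suc n) (λ l → Σ-extend (s≤s (m∸n≤m n (k * k))) (λ {j} t<j _ → ·-no (_ ≟ n) (<⇒≱ t<j ∘′ j-bound {l} {j}))))
      (Σ-extend (s≤s (m∸n≤m n (k * k))) (λ {l} t<l _ → Σ-zero (suc t) (λ {j} _ → ·-no (_ ≟ n) (<⇒≱ t<l ∘′ l-bound {l} {j}))))

  m+[m+2n]≡2[m+n] : ∀ m n → m + (m + 2 * n) ≡ 2 * (m + n)
  m+[m+2n]≡2[m+n] = solve-∀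

  twice-squares-convolution : ∀ n →
    Σ (suc n) (λ k → Σ (suc n) (λ j → [ does (k * k + (k * k + 2 * j) ≟ n) ]· S̄ j)) ≡ does (n ≟ 0)
  twice-squares-convolution n with even-or-odd n
  ... | inj₂ (m , refl) = Σ-zero (suc n) (λ {k} _ → Σ-zero (suc n) (λ {j} _ → ·-no (_ ≟ n)
                            (λ e → even≢odd (k * k + j) m (trans (sym (m+[m+2n]≡2[m+n] (k * k) j)) e))))
  ... | inj₁ (m , refl) = begin
    Σ (suc n) (λ k → Σ (suc n) (λ j → [ does (k * k + (k * k + 2 * j) ≟ 2 * m) ]· S̄ j))
      ≡⟨ Σ-cong (suc n) (λ k → Σ-shifted-delta (suc n) (k * k) m S̄ (λ j → _ ≟ 2 * m)
           (λ j e → *-cancelˡ-≡ _ _ 2 (trans (sym (m+[m+2n]≡2[m+n] (k * k) j)) e))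
           (λ j e → trans (m+[m+2n]≡2[m+n] (k * k) j) (cong (2 *_) e))
           (s≤s m≤2m)) ⟩
    Σ (suc n) (λ k → [ does (k * k <? suc m) ]· S̄ (m ∸ k * k))
      ≡⟨ Σ-extend (s≤s m≤2m) (λ {k} m<k _ → ·-no (k * k <? suc m) (λ k²≤m → <⇒≱ m<k (≤-trans (n≤n*n k) (≤-pred k²≤m)))) ⟩
    Σ (suc m) (λ k → [ does (k * k <? suc m) ]· S̄ (m ∸ k * k))
      ≡⟨ S̄-isSquareReciprocal m ⟩
    does (m ≟ 0)
      ≡⟨ does-⇔ (λ { refl → refl }) (λ e → m+n≡0⇒m≡0 m e) (m ≟ 0) (2 * m ≟ 0) ⟩
    does (2 * m ≟ 0)  ∎
    where
    m≤2m = m≤m+n m (m + 0)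

  D-isSquareReciprocal : IsSquareReciprocal D
  D-isSquareReciprocal n = begin
    Σ N (λ k → [ does (k * k <? N) ]· D (n ∸ k * k))
      ≡⟨ Σ-cong N (D-shift n) ⟩
    Σ N (λ k → Σ N (λ l → Σ N (λ j → [ does (k * k + (l * l + 2 * j) ≟ n) ]· S̄ j)))
      ≡⟨ trans (Σ-cong N (λ k → Σ-swap N N _)) (Σ-swap N N _) ⟩
    Σ N (λ j → Σ N (λ k → Σ N (λ l → [ does (k * k + (l * l + 2 * j) ≟ n) ]· S̄ j)))
      ≡⟨ Σ-cong N (λ j → trans (Σ-cong N (λ k → Σ-·ˡ N _ (S̄ j))) (Σ-·ˡ N _ (S̄ j))) ⟩
    Σ N (λ j → [ Σ N (λ k → Σ N (λ l → does (k * k + (l * l + 2 * j) ≟ n))) ]· S̄ j)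
      ≡⟨ Σ-cong N (λ j → cong ([_]· S̄ j) (Σ-symmetric N _ (λ k l → cong (λ s → does (s ≟ n)) (swap k l j)))) ⟩
    Σ N (λ j → [ Σ N (λ k → does (k * k + (k * k + 2 * j) ≟ n)) ]· S̄ j)
      ≡⟨ trans (Σ-cong N (λ j → sym (Σ-·ˡ N _ (S̄ j)))) (Σ-swap N N _) ⟩
    Σ N (λ k → Σ N (λ j → [ does (k * k + (k * k + 2 * j) ≟ n) ]· S̄ j))
      ≡⟨ twice-squares-convolution n ⟩
    does (n ≟ 0)  ∎
    where
    N = suc n
    swap : ∀ k l j → k * k + (l * l + 2 * j) ≡ l * l + (k * k + 2 * j)
    swap = solve-∀

  S̄≡D : ∀ n → S̄ n ≡ D n
  S̄≡D = squareReciprocal-unique S̄-isSquareReciprocal D-isSquareReciprocal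

  -- Coefficients of S(q²)·S̄(q).
  T : ℕ → Bool
  T m = Σ (suc m) (λ r → [ does (2 * (r * r) <? suc m) ]· S̄ (m ∸ 2 * (r * r)))

  S̄-even≡T : ∀ m → S̄ (2 * m) ≡ T m
  S̄-even≡T m = begin
    S̄ (2 * m)          ≡⟨ S̄≡D (2 * m) ⟩
    Σ (suc (2 * m)) F  ≡⟨ Σ-extend (n≤1+n _) (λ 2m<l _ → F-vanishes 2m<l) ⟨
    Σ (2 + 2 * m) F    ≡⟨ cong (λ N → Σ N F) (*-suc 2 m) ⟨
    Σ (2 * suc m) F    ≡⟨ Σ-even-odd (suc m) F ⟩
    Σ (suc m) (λ r → F (2 * r)) xor Σ (suc m) (λ r → F (suc (2 * r)))
      ≡⟨ cong₂ _xor_ (Σ-cong (suc m) F-even) (Σ-zero (suc m) (λ {r} _ → F-odd r)) ⟩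
    T m xor false      ≡⟨ xor-identityʳ _ ⟩
    T m                ∎
    where
    F : ℕ → Bool
    F l = Σ (suc (2 * m)) (λ j → [ does (l * l + 2 * j ≟ 2 * m) ]· S̄ j)

    F-vanishes : ∀ {l} → 2 * m < l → F l ≡ false
    F-vanishes {l} 2m<l = Σ-zero (suc (2 * m)) (λ _ → ·-no (_ ≟ 2 * m)
      (λ e → <⇒≱ 2m<l (subst (l ≤_) e (≤-trans (n≤n*n l) (m≤m+n _ _)))))

    F-odd : ∀ r → F (suc (2 * r)) ≡ false
    F-odd r = Σ-zero (suc (2 * m)) (λ {j} _ → ·-no (_ ≟ 2 * m)
      (λ e → even≢odd m (2 * (r * r) + 2 * r + j) (sym (trans (odd-square r j) e))))
      where
      odd-square : ∀ r j → suc (2 * (2 * (r * r) + 2 * r + j)) ≡ suc (2 * r) * suc (2 * r) + 2 * j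
      odd-square = solve-∀

    F-even : ∀ r → F (2 * r) ≡ [ does (2 * (r * r) <? suc m) ]· S̄ (m ∸ 2 * (r * r))
    F-even r = Σ-shifted-delta (suc (2 * m)) (2 * (r * r)) m S̄ (λ j → _ ≟ 2 * m)
      (λ j e → *-cancelˡ-≡ _ _ 2 (trans (sym (even-square r j)) e))
      (λ j e → trans (even-square r j) (cong (2 *_) e))
      (s≤s (m≤m+n m (m + 0)))
      where
      even-square : ∀ r j → 2 * r * (2 * r) + 2 * j ≡ 2 * (2 * (r * r) + j)
      even-square = solve-∀

  S≡T : ∀ m → S m ≡ T m
  S≡T m = begin
    S m                                              ≡⟨ ·-yes (m <? suc m) ≤-refl ⟨
    [ does (m <? suc m) ]· S m                       ≡⟨ Σ-delta (suc m) m S ⟨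
    Σ (suc m) (λ t → [ does (m ≟ t) ]· S t)
      ≡⟨ Σ-cong-< (suc m) (λ {t} t≤m → trans (·-comm _ (S t)) (cong ([ S t ]·_) (sym (W≡δ (≤-pred t≤m))))) ⟩
    Σ (suc m) (λ t → [ S t ]· W t)                   ≡⟨ Σ-squares (suc m) W ⟩
    Σ (suc m) (λ k → [ does (k * k <? suc m) ]· W (k * k))
      ≡⟨ Σ-cong (suc m) (λ k → trans (sym (Σ-[]· (suc m) _ _)) (Σ-cong (suc m) (merge k))) ⟩
    Σ (suc m) (λ k → Σ (suc m) (λ s → R (k * k + s * s)))
      ≡⟨ Σ-symmetric (suc m) _ (λ k s → cong R (+-comm (k * k) (s * s))) ⟩
    Σ (suc m) (λ k → R (k * k + k * k))
      ≡⟨ Σ-cong (suc m) (λ k → cong R (cong (k * k +_) (sym (+-identityʳ (k * k))))) ⟩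
    T m                                              ∎
    where
    W : ℕ → Bool
    W t = Σ (suc m) (λ s → [ does (s * s <? suc (m ∸ t)) ]· S̄ (m ∸ t ∸ s * s))

    R : ℕ → Bool
    R u = [ does (u <? suc m) ]· S̄ (m ∸ u)

    W≡δ : ∀ {t} → t ≤ m → W t ≡ does (m ≟ t)
    W≡δ {t} t≤m = begin
      W t
        ≡⟨ Σ-extend (s≤s (m∸n≤m m t)) (λ {s} m-t<s _ → ·-no (s * s <? suc (m ∸ t))
             (λ s²≤m-t → <⇒≱ m-t<s (≤-trans (n≤n*n s) (≤-pred s²≤m-t)))) ⟩
      Σ (suc (m ∸ t)) (λ s → [ does (s * s <? suc (m ∸ t)) ]· S̄ (m ∸ t ∸ s * s))
        ≡⟨ S̄-isSquareReciprocal (m ∸ t) ⟩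
      does (m ∸ t ≟ 0)
        ≡⟨ does-⇔ (λ e → ≤-antisym (m∸n≡0⇒m≤n e) t≤m) (λ { refl → n∸n≡0 m }) (m ∸ t ≟ 0) (m ≟ t) ⟩
      does (m ≟ t)  ∎

    merge : ∀ k s → [ does (k * k <? suc m) ]· [ does (s * s <? suc (m ∸ k * k)) ]· S̄ (m ∸ k * k ∸ s * s)
                  ≡ R (k * k + s * s)
    merge k s = trans (·-∧ (does (k * k <? suc m)) (does (s * s <? suc (m ∸ k * k))) _) (cong₂ [_]·_
      (does-⇔ (λ (k²≤m , s²≤m-k²) → s≤s (subst (_≤ m) (+-comm (s * s) (k * k)) (m≤o∸n⇒m+n≤o (s * s) (≤-pred k²≤m) (≤-pred s²≤m-k²))))
              (λ k²+s²≤m → s≤s (m+n≤o⇒m≤o (k * k) (≤-pred k²+s²≤m))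
                         , s≤s (m+n≤o⇒m≤o∸n (s * s) (subst (_≤ m) (+-comm (k * k) (s * s)) (≤-pred k²+s²≤m))))
              ((k * k <? suc m) ×-dec (s * s <? suc (m ∸ k * k))) (k * k + s * s <? suc m))
      (cong S̄ (∸-+-assoc m (k * k) (s * s))))

  S̄-even : ∀ m → S̄ (2 * m) ≡ S m
  S̄-even m = trans (S̄-even≡T m) (sym (S≡T m))

  S̄-1mod4 : ∀ a → S̄ (suc (4 * a)) ≡ #x²+4y² (suc (4 * a))
  S̄-1mod4 a = trans (S̄≡D n) (Σ-cong (suc n) column)
    where
    n = suc (4 * a)

    column : ∀ x → Σ (suc n) (λ j → [ does (x * x + 2 * j ≟ n) ]· S̄ j) ≡ Σ (suc n) (λ y → does (x * x + 4 * (y * y) ≟ n))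
    column x = begin
      Σ (suc n) F                                       ≡⟨ Σ-extend (m≤n*m (suc n) 2) (λ n<j _ → F-vanishes n<j) ⟨
      Σ (2 * suc n) F                                   ≡⟨ Σ-even-odd (suc n) F ⟩
      Σ (suc n) (λ j → F (2 * j)) xor Σ (suc n) (λ j → F (suc (2 * j)))
        ≡⟨ cong (Σ (suc n) (λ j → F (2 * j)) xor_) (Σ-zero (suc n) (λ {j} _ → ·-no (_ ≟ n) (x²+2[1+2j]≢1+4a x j a))) ⟩
      Σ (suc n) (λ j → F (2 * j)) xor false             ≡⟨ xor-identityʳ _ ⟩
      Σ (suc n) (λ j → F (2 * j))
        ≡⟨ Σ-cong (suc n) (λ j → trans (cong ([ does (x * x + 2 * (2 * j) ≟ n) ]·_) (S̄-even j)) (·-comm _ (S j))) ⟩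
      Σ (suc n) (λ j → [ S j ]· does (x * x + 2 * (2 * j) ≟ n))
                                                        ≡⟨ Σ-squares (suc n) (λ j → does (x * x + 2 * (2 * j) ≟ n)) ⟩
      Σ (suc n) (λ y → [ does (y * y <? suc n) ]· does (x * x + 2 * (2 * (y * y)) ≟ n))
                                                        ≡⟨ Σ-cong (suc n) drop-range ⟩
      Σ (suc n) (λ y → does (x * x + 4 * (y * y) ≟ n))  ∎
      where
      F : ℕ → Bool
      F j = [ does (x * x + 2 * j ≟ n) ]· S̄ j

      F-vanishes : ∀ {j} → n < j → F j ≡ false
      F-vanishes {j} n<j = ·-no (_ ≟ n) (λ e → <⇒≱ n<j (subst (j ≤_) e (≤-trans (m≤n*m j 2) (m≤n+m (2 * j) (x * x)))))

      drop-range : ∀ y → [ does (y * y <? suc n) ]· does (x * x + 2 * (2 * (y * y)) ≟ n) ≡ does (x * x + 4 * (y * y) ≟ n)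
      drop-range y with y * y <? suc n
      ... | yes y²≤n = trans (·-yes (y * y <? suc n) y²≤n) (cong (λ s → does (x * x + s ≟ n)) (sym (*-assoc 2 2 (y * y))))
      ... | no  y²>n = trans (·-no (y * y <? suc n) y²>n) (sym (dec-false (_ ≟ n)
                         (λ e → y²>n (s≤s (subst (y * y ≤_) e (≤-trans (m≤n*m (y * y) 4) (m≤n+m (4 * (y * y)) (x * x))))))))

module Zagier (n b : ℕ) (n-odd : n ≡ suc (2 * b)) where

  open import Data.Nat using (_+_; _∸_; _<_; _≤_; z≤n; s≤s; z<s; >-nonZero)
  open import Data.Nat.Properties
  open import Data.Nat.Tactic.RingSolver using (solve)
  open import Data.List using (_∷_; [])
  open import Data.Bool using (false; _∧_; _xor_)
  open import Data.Product using (_,_; proj₁; proj₂)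
  open import Data.Sum using (inj₁; inj₂)
  open import Data.Empty using (⊥-elim)
  open import Relation.Nullary using (Dec; yes; no; does; _×-dec_; ¬?)
  open import Relation.Nullary.Decidable using (dec-true; dec-false)
  open import Relation.Binary.PropositionalEquality
  open import Function using (_∘′_)
  open Basics
  open ParitySum
  open ≡-Reasoning

  -- Zagier's involution of the solutions of x² + 4yz = n.
  zagier : ℕ³ → ℕ³
  zagier (x , y , z) with x + z <? y | x <? 2 * y
  ... | yes _ | _     = (x + 2 * z , z , y ∸ (x + z))
  ... | no _  | yes _ = (2 * y ∸ x , y , x + z ∸ y)
  ... | no _  | no _  = (x ∸ 2 * y , x + z ∸ y , y)

  zagier-A : ∀ x y z → x + z < y → zagier (x , y , z) ≡ (x + 2 * z , z , y ∸ (x + z))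
  zagier-A x y z h with x + z <? y
  ... | yes _ = refl
  ... | no ¬h = ⊥-elim (¬h h)

  zagier-B : ∀ x y z → ¬ x + z < y → x < 2 * y → zagier (x , y , z) ≡ (2 * y ∸ x , y , x + z ∸ y)
  zagier-B x y z ¬h h′ with x + z <? y | x <? 2 * y
  ... | yes h | _      = ⊥-elim (¬h h)
  ... | no _  | yes _  = refl
  ... | no _  | no ¬h′ = ⊥-elim (¬h′ h′)

  zagier-C : ∀ x y z → ¬ x + z < y → ¬ x < 2 * y → zagier (x , y , z) ≡ (x ∸ 2 * y , x + z ∸ y , y)
  zagier-C x y z ¬h ¬h′ with x + z <? y | x <? 2 * y
  ... | yes h | _     = ⊥-elim (¬h h)
  ... | no _  | yes h = ⊥-elim (¬h′ h)
  ... | no _  | no _  = refl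

  Solution : ℕ³ → Set
  Solution (x , y , z) = x * x + 4 * (y * z) ≡ n × 0 < y × 0 < z

  solution? : ∀ p → Dec (Solution p)
  solution? (x , y , z) = (x * x + 4 * (y * z) ≟ n) ×-dec (0 <? y) ×-dec (0 <? z)

  -- The solutions with x + z = y are the ones with n = (x + 2z)²; zagier is an involution away from them.
  Regular : ℕ³ → Set
  Regular p@(x , y , z) = Solution p × x + z ≢ y

  regular? : ∀ p → Dec (Regular p)
  regular? p@(x , y , z) = solution? p ×-dec ¬? (x + z ≟ y)

  InvolutionAt : ℕ³ → Set
  InvolutionAt p@(x , y , z) = Regular p → (Regular (zagier p) × zagier (zagier p) ≡ p) × (zagier p ≡ p → x ≡ y)

  solution-x-odd : ∀ x y z → x * x + 4 * (y * z) ≡ n → ∃[ u ] x ≡ suc (2 * u)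
  solution-x-odd x y z e with even-or-odd x
  ... | inj₂ odd-x        = odd-x
  ... | inj₁ (u , refl) = ⊥-elim (even≢odd (2 * (u * u) + 2 * (y * z)) b (trans (expand u) (trans e n-odd)))
    where
    expand : ∀ u → 2 * (2 * (u * u) + 2 * (y * z)) ≡ 2 * u * (2 * u) + 4 * (y * z)
    expand u = solve (u ∷ y ∷ z ∷ [])

  paired : ∀ {p q} → zagier p ≡ q → zagier q ≡ p → Regular q → Regular (zagier p) × zagier (zagier p) ≡ p
  paired p↦q q↦p q-regular = subst Regular (sym p↦q) q-regular , trans (cong zagier p↦q) q↦p

  small-x : ∀ x z w → InvolutionAt (x , x + z + suc w , z)
  small-x x z w ((sol , _ , 0<z) , _) = paired p↦q q↦p ((q-sol , 0<z , z<s) , q-regular) , fixed⇒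
    where
    y = x + z + suc w
    q = (x + 2 * z , z , suc w)

    q-sum : x + 2 * z + suc w ≡ x + z + suc w + z
    q-sum = solve (x ∷ z ∷ w ∷ [])

    z<y : z < y
    z<y = ≤-<-trans (m≤n+m z x) (m<m+n (x + z) z<s)

    p↦q : zagier (x , y , z) ≡ q
    p↦q = trans (zagier-A x y z (m<m+n (x + z) z<s)) (cong (λ t → (x + 2 * z , z , t)) (m+n∸m≡n (x + z) (suc w)))

    q↦p : zagier q ≡ (x , y , z)
    q↦p = trans (zagier-C (x + 2 * z) z (suc w) (λ h → <⇒≱ h (subst (z ≤_) (sym q-sum) (m≤n+m z y)))
                                              (λ h → <⇒≱ h (m≤n+m (2 * z) x)))
                (cong₂ (λ a c → (a , c , z)) (m+n∸n≡m x (2 * z)) (trans (cong (_∸ z) q-sum) (m+n∸n≡m y z)))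

    q-sol : (x + 2 * z) * (x + 2 * z) + 4 * (z * suc w) ≡ n
    q-sol = begin
      (x + 2 * z) * (x + 2 * z) + 4 * (z * suc w)  ≡⟨ solve (x ∷ z ∷ w ∷ []) ⟩
      x * x + 4 * ((x + z + suc w) * z)            ≡⟨ sol ⟩
      n                                            ∎

    q-regular : x + 2 * z + suc w ≢ z
    q-regular eq = <-irrefl (sym eq) (subst (z <_) (sym q-sum) (m<n+m z (≤-<-trans z≤n z<y)))

    fixed⇒ : zagier (x , y , z) ≡ (x , y , z) → x ≡ y
    fixed⇒ fixed = ⊥-elim (<-irrefl (cong (proj₁ ∘′ proj₂) (trans (sym p↦q) fixed)) z<y)

  middle-x≤y : ∀ x d c → 0 < x → InvolutionAt (x , x + d , d + suc c)
  middle-x≤y x d c 0<x ((sol , _ , _) , _) = paired p↦q q↦p ((q-sol , ≤-trans 0<x (m≤m+n x d) , z<s) , q-regular) , fixed⇒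
    where
    y = x + d
    z = d + suc c
    q = (x + 2 * d , y , suc c)

    2y≡x+q₁ : 2 * (x + d) ≡ x + (x + 2 * d)
    2y≡x+q₁ = solve (x ∷ d ∷ [])

    2y≡q₁+x : 2 * (x + d) ≡ x + 2 * d + x
    2y≡q₁+x = solve (x ∷ d ∷ [])

    q-sum : x + 2 * d + suc c ≡ x + d + (d + suc c)
    q-sum = solve (x ∷ d ∷ c ∷ [])

    p↦q : zagier (x , y , z) ≡ q
    p↦q = trans (zagier-B x y z (λ h → <⇒≱ h (+-monoʳ-≤ x (m≤m+n d (suc c))))
                                (subst (x <_) (sym 2y≡x+q₁) (m<m+n x (≤-trans 0<x (m≤m+n x _)))))
                (cong₂ (λ a t → (a , y , t)) (trans (cong (_∸ x) 2y≡x+q₁) (m+n∸m≡n x _))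
                                             (trans (cong (_∸ y) (sym (+-assoc x d (suc c)))) (m+n∸m≡n y _)))

    q↦p : zagier q ≡ (x , y , z)
    q↦p = trans (zagier-B (x + 2 * d) y (suc c) (λ h → <⇒≱ h (subst (y ≤_) (sym q-sum) (m≤m+n y z)))
                                                (subst (x + 2 * d <_) (sym 2y≡q₁+x) (m<m+n (x + 2 * d) 0<x)))
                (cong₂ (λ a t → (a , y , t)) (trans (cong (_∸ (x + 2 * d)) 2y≡q₁+x) (m+n∸m≡n (x + 2 * d) x))
                                             (trans (cong (_∸ y) q-sum) (m+n∸m≡n y z)))

    q-sol : (x + 2 * d) * (x + 2 * d) + 4 * (y * suc c) ≡ n
    q-sol = begin
      (x + 2 * d) * (x + 2 * d) + 4 * ((x + d) * suc c)  ≡⟨ solve (x ∷ d ∷ c ∷ []) ⟩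
      x * x + 4 * ((x + d) * (d + suc c))                ≡⟨ sol ⟩
      n                                            ∎

    q-regular : x + 2 * d + suc c ≢ y
    q-regular eq = <-irrefl (sym eq) (subst (y <_) (sym q-sum) (m<m+n y (≤-trans (s≤s z≤n) (m≤n+m (suc c) d))))

    fixed⇒ : zagier (x , y , z) ≡ (x , y , z) → x ≡ y
    fixed⇒ fixed = sym (trans (cong (x +_) d≡0) (+-identityʳ x))
      where
      d≡0 : d ≡ 0
      d≡0 = m+n≡0⇒m≡0 d (+-cancelˡ-≡ x _ _ (trans (cong proj₁ (trans (sym p↦q) fixed)) (sym (+-identityʳ x))))

  middle-x>y : ∀ d e z₀ → InvolutionAt (suc d + suc e + suc d , suc d + suc e , suc z₀)
  middle-x>y d e z₀ ((sol , _ , _) , _) = paired p↦q q↦p ((q-sol , z<s , z<s) , q-regular) , fixed⇒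
    where
    y = suc d + suc e
    x = y + suc d
    z = suc z₀
    q = (suc e , y , suc d + z)

    2y≡x+q₁ : 2 * (suc d + suc e) ≡ suc d + suc e + suc d + suc e
    2y≡x+q₁ = solve (d ∷ e ∷ [])

    2y≡q₁+x : 2 * (suc d + suc e) ≡ suc e + (suc d + suc e + suc d)
    2y≡q₁+x = solve (d ∷ e ∷ [])

    q-sum : suc e + (suc d + suc z₀) ≡ suc d + suc e + suc z₀
    q-sum = solve (d ∷ e ∷ z₀ ∷ [])

    x≡q₁+2d : suc d + suc e + suc d ≡ suc e + (suc d + suc d)
    x≡q₁+2d = solve (d ∷ e ∷ [])

    p↦q : zagier (x , y , z) ≡ q
    p↦q = trans (zagier-B x y z (λ h → <⇒≱ h (subst (y ≤_) (sym (+-assoc y (suc d) z)) (m≤m+n y _)))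
                                (subst (x <_) (sym 2y≡x+q₁) (m<m+n x z<s)))
                (cong₂ (λ a t → (a , y , t)) (trans (cong (_∸ x) 2y≡x+q₁) (m+n∸m≡n x (suc e)))
                                             (trans (cong (_∸ y) (+-assoc y (suc d) z)) (m+n∸m≡n y _)))

    q↦p : zagier q ≡ (x , y , z)
    q↦p = trans (zagier-B (suc e) y (suc d + z) (λ h → <⇒≱ h (subst (y ≤_) (sym q-sum) (m≤m+n y z)))
                                                (subst (suc e <_) (sym 2y≡q₁+x) (m<m+n (suc e) z<s)))
                (cong₂ (λ a t → (a , y , t)) (trans (cong (_∸ suc e) 2y≡q₁+x) (m+n∸m≡n (suc e) x))
                                             (trans (cong (_∸ y) q-sum) (m+n∸m≡n y z)))

    q-sol : suc e * suc e + 4 * ((suc d + suc e) * (suc d + suc z₀)) ≡ n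
    q-sol = begin
      suc e * suc e + 4 * ((suc d + suc e) * (suc d + suc z₀))                        ≡⟨ solve (d ∷ e ∷ z₀ ∷ []) ⟩
      (suc d + suc e + suc d) * (suc d + suc e + suc d) + 4 * ((suc d + suc e) * suc z₀)  ≡⟨ sol ⟩
      n                                                                              ∎

    q-regular : suc e + (suc d + z) ≢ y
    q-regular eq = <-irrefl (sym eq) (subst (y <_) (sym q-sum) (m<m+n y z<s))

    fixed⇒ : zagier (x , y , z) ≡ (x , y , z) → x ≡ y
    fixed⇒ fixed = ⊥-elim (<-irrefl (cong proj₁ (trans (sym p↦q) fixed))
                                    (subst (suc e <_) (sym x≡q₁+2d) (m<m+n (suc e) z<s)))

  large-x : ∀ y₀ u z₀ → InvolutionAt (2 * suc y₀ + suc u , suc y₀ , suc z₀)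
  large-x y₀ u z₀ ((sol , _ , _) , _) = paired p↦q q↦p ((q-sol , z<s , z<s) , q-regular) , fixed⇒
    where
    y = suc y₀
    x = 2 * y + suc u
    z = suc z₀
    q = (suc u , y + suc u + z , y)

    xz-sum : 2 * suc y₀ + suc u + suc z₀ ≡ suc y₀ + (suc y₀ + suc u + suc z₀)
    xz-sum = solve (y₀ ∷ u ∷ z₀ ∷ [])

    q-sum : suc y₀ + suc u + suc z₀ ≡ suc u + suc y₀ + suc z₀
    q-sum = solve (y₀ ∷ u ∷ z₀ ∷ [])

    p↦q : zagier (x , y , z) ≡ q
    p↦q = trans (zagier-C x y z (λ h → <⇒≱ h (subst (y ≤_) (sym xz-sum) (m≤m+n y _))) (λ h → <⇒≱ h (m≤m+n (2 * y) (suc u))))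
                (cong₂ (λ a t → (a , t , y)) (m+n∸m≡n (2 * y) (suc u)) (trans (cong (_∸ y) xz-sum) (m+n∸m≡n y _)))

    q↦p : zagier q ≡ (x , y , z)
    q↦p = trans (zagier-A (suc u) (y + suc u + z) y (subst (suc u + y <_) (sym q-sum) (m<m+n (suc u + y) z<s)))
                (cong₂ (λ a t → (a , y , t)) (+-comm (suc u) (2 * y))
                                             (trans (cong (_∸ (suc u + y)) q-sum) (m+n∸m≡n (suc u + y) z)))

    q-sol : suc u * suc u + 4 * ((suc y₀ + suc u + suc z₀) * suc y₀) ≡ n
    q-sol = begin
      suc u * suc u + 4 * ((suc y₀ + suc u + suc z₀) * suc y₀)             ≡⟨ solve (y₀ ∷ u ∷ z₀ ∷ []) ⟩
      (2 * suc y₀ + suc u) * (2 * suc y₀ + suc u) + 4 * (suc y₀ * suc z₀)  ≡⟨ sol ⟩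
      n                                                                   ∎

    q-regular : suc u + y ≢ y + suc u + z
    q-regular eq = <-irrefl eq (subst (suc u + y <_) (sym q-sum) (m<m+n (suc u + y) z<s))

    fixed⇒ : zagier (x , y , z) ≡ (x , y , z) → x ≡ y
    fixed⇒ fixed = ⊥-elim (<-irrefl (cong proj₁ (trans (sym p↦q) fixed)) (m<n+m (suc u) {2 * y} z<s))

  classify : ∀ x y z → Dec (x + z < y) → Dec (x < 2 * y) → Dec (x ≤ y) → InvolutionAt (x , y , z)
  classify x y z (yes x+z<y) _ _ with <-offset x+z<y
  ... | w , refl = small-x x z w
  classify x y z (no x+z≮y) (yes x<2y) (yes x≤y) reg@((sol , _ , _) , x+z≢y)
    with ≤-offset x≤y | solution-x-odd x y z sol
  ... | d , refl | u , refl with <-offset (+-cancelˡ-< x d z (≤∧≢⇒< (≮⇒≥ x+z≮y) (x+z≢y ∘′ sym)))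
  ...   | c , refl = middle-x≤y (suc (2 * u)) d c z<s reg
  classify x y z (no x+z≮y) (yes x<2y) (no x≰y) reg@((_ , _ , 0<z) , _)
    with <-offset (≰⇒> x≰y)
  ... | d , refl with <-offset (+-cancelˡ-< y (suc d) y (subst (y + suc d <_) (cong (y +_) (+-identityʳ y)) x<2y))
  ...   | e , refl with 0<z
  ...     | s≤s {n = z₀} _ = middle-x>y d e z₀ reg
  classify x y z (no x+z≮y) (no x≮2y) _ reg@((sol , 0<y , 0<z) , _)
    with solution-x-odd x y z sol
  ... | u , x≡1+2u with <-offset (≤∧≢⇒< (≮⇒≥ x≮2y) (λ 2y≡x → even≢odd y u (trans 2y≡x x≡1+2u)))
  ...   | u′ , refl with 0<y | 0<z
  ...     | s≤s {n = y₀} _ | s≤s {n = z₀} _ = large-x y₀ u′ z₀ reg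

  zagier-involution : ∀ p → InvolutionAt p
  zagier-involution (x , y , z) = classify x y z (x + z <? y) (x <? 2 * y) (x ≤? y)

  solution-inBox : ∀ p → Solution p → InBox (suc n) p
  solution-inBox (x , y , z) (sol , 0<y , 0<z) =
      s≤s (≤-trans (n≤n*n x) (m+n≡o⇒m≤o (x * x) _ sol))
    , s≤s (≤-trans (m≤m*n y z) yz≤n)
    , s≤s (≤-trans (m≤n*m z y) yz≤n)
    where
    instance
      _ = >-nonZero 0<y
      _ = >-nonZero 0<z
    yz≤n : y * z ≤ n
    yz≤n = ≤-trans (m≤n*m (y * z) 4) (m+n≡o⇒m≤o (4 * (y * z)) (x * x) (trans (+-comm _ (x * x)) sol))

  diagonal-fixed : ∀ x z → Solution (x , x , z) → zagier (x , x , z) ≡ (x , x , z)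
  diagonal-fixed x z (_ , 0<x , _) = trans (zagier-B x x z (λ h → <⇒≱ h (m≤m+n x z)) x<2x)
    (cong₂ (λ a c → (a , x , c)) (trans (cong (_∸ x) 2x≡x+x) (m+n∸m≡n x x)) (m+n∸m≡n x z))
    where
    2x≡x+x : 2 * x ≡ x + x
    2x≡x+x = cong (x +_) (+-identityʳ x)
    x<2x : x < 2 * x
    x<2x = subst (x <_) (sym 2x≡x+x) (m<m+n x 0<x)

  onDiagonal onBoundary : ℕ³ → Bool
  onDiagonal (x , y , z) = does (x ≟ y)
  onBoundary (x , y , z) = does (x + z ≟ y)

  fixed⇔diagonal : ∀ p → does (regular? p) ∧ does (zagier p ≟³ p) ≡ does (solution? p) ∧ onDiagonal p
  fixed⇔diagonal p@(x , y , z) = does-⇔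
    (λ (reg , fixed) → proj₁ reg , proj₂ (zagier-involution p reg) fixed)
    (λ { (sol@(_ , _ , 0<z) , refl) → (sol , λ eq → <-irrefl (sym eq) (m<m+n x 0<z)) , diagonal-fixed x z sol })
    (regular? p ×-dec (zagier p ≟³ p)) (solution? p ×-dec (x ≟ y))

  #solutions : Bool
  #solutions = Σ³ (suc n) (λ p → does (solution? p))

  #solutions≡y=z : #solutions ≡ Σ (suc n) (λ x → Σ (suc n) (λ y → does (solution? (x , y , y))))
  #solutions≡y=z = Σ-cong (suc n) (λ x → Σ-symmetric (suc n) (λ y z → does (solution? (x , y , z))) (swap-yz x))
    where
    swap-yz : ∀ x y z → does (solution? (x , y , z)) ≡ does (solution? (x , z , y))
    swap-yz x y z = does-⇔ (λ (sol , 0<y , 0<z) → trans (cong (λ t → x * x + 4 * t) (*-comm z y)) sol , 0<z , 0<y)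
                           (λ (sol , 0<z , 0<y) → trans (cong (λ t → x * x + 4 * t) (*-comm y z)) sol , 0<y , 0<z)
                           (solution? (x , y , z)) (solution? (x , z , y))

  #diagonalSolutions #boundarySolutions : Bool
  #diagonalSolutions = Σ (suc n) (λ x → Σ (suc n) (λ z → does (solution? (x , x , z))))
  #boundarySolutions = Σ (suc n) (λ x → Σ (suc n) (λ z → does (solution? (x , x + z , z))))

  Σ³-onDiagonal : Σ³ (suc n) (λ p → does (solution? p) ∧ onDiagonal p) ≡ #diagonalSolutions
  Σ³-onDiagonal = Σ-cong-< (suc n) column
    where
    column : ∀ {x} → x < suc n → Σ (suc n) (λ y → Σ (suc n) (λ z → does (solution? (x , y , z)) ∧ does (x ≟ y)))
                               ≡ Σ (suc n) (λ z → does (solution? (x , x , z)))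
    column {x} x≤n = begin
      Σ (suc n) (λ y → Σ (suc n) (λ z → does (solution? (x , y , z)) ∧ does (x ≟ y)))
        ≡⟨ Σ-cong (suc n) (λ y → trans (Σ-cong (suc n) (λ z → ∧≡· (does (solution? (x , y , z))) (does (x ≟ y))))
                                       (Σ-[]· (suc n) _ _)) ⟩
      Σ (suc n) (λ y → [ does (x ≟ y) ]· Σ (suc n) (λ z → does (solution? (x , y , z))))
        ≡⟨ Σ-delta (suc n) x _ ⟩
      [ does (x <? suc n) ]· Σ (suc n) (λ z → does (solution? (x , x , z)))
        ≡⟨ ·-yes (x <? suc n) x≤n ⟩
      Σ (suc n) (λ z → does (solution? (x , x , z)))  ∎

  Σ³-onBoundary : Σ³ (suc n) (λ p → does (solution? p) ∧ onBoundary p) ≡ #boundarySolutions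
  Σ³-onBoundary = Σ-cong (suc n) (λ x → trans (Σ-swap (suc n) (suc n) _) (Σ-cong (suc n) (row x)))
    where
    row : ∀ x z → Σ (suc n) (λ y → does (solution? (x , y , z)) ∧ does (x + z ≟ y)) ≡ does (solution? (x , x + z , z))
    row x z = begin
      Σ (suc n) (λ y → does (solution? (x , y , z)) ∧ does (x + z ≟ y))
        ≡⟨ Σ-cong (suc n) (λ y → ∧≡· (does (solution? (x , y , z))) (does (x + z ≟ y))) ⟩
      Σ (suc n) (λ y → [ does (x + z ≟ y) ]· does (solution? (x , y , z)))  ≡⟨ Σ-delta (suc n) (x + z) _ ⟩
      [ does (x + z <? suc n) ]· does (solution? (x , x + z , z))          ≡⟨ in-range (x + z <? suc n) ⟩
      does (solution? (x , x + z , z))                                    ∎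
      where
      in-range : (x+z≤n? : Dec (x + z < suc n)) → [ does x+z≤n? ]· does (solution? (x , x + z , z))
                                                ≡ does (solution? (x , x + z , z))
      in-range (yes x+z≤n) = refl
      in-range (no  x+z>n) = sym (dec-false (solution? (x , x + z , z))
                                            (x+z>n ∘′ proj₁ ∘′ proj₂ ∘′ solution-inBox (x , x + z , z)))

  #solutions≡diagonal+boundary : #solutions ≡ #diagonalSolutions xor #boundarySolutions
  #solutions≡diagonal+boundary = begin
    #solutions                                           ≡⟨ Σ³-cong (suc n) split ⟩
    Σ³ (suc n) (λ p → does (regular? p) xor Boundary p)  ≡⟨ Σ³-distrib (suc n) _ _ ⟩
    Σ³ (suc n) (λ p → does (regular? p)) xor ΣBoundary
      ≡⟨ cong (_xor ΣBoundary) (Σ³-fixed-points (suc n) _ zagier inBox invol) ⟩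
    Σ³ (suc n) (λ p → does (regular? p) ∧ does (zagier p ≟³ p)) xor ΣBoundary
                                                         ≡⟨ cong (_xor ΣBoundary) (Σ³-cong (suc n) fixed⇔diagonal) ⟩
    Σ³ (suc n) (λ p → does (solution? p) ∧ onDiagonal p) xor ΣBoundary  ≡⟨ cong₂ _xor_ Σ³-onDiagonal Σ³-onBoundary ⟩
    #diagonalSolutions xor #boundarySolutions                          ∎
    where
    Boundary : ℕ³ → Bool
    Boundary p = does (solution? p) ∧ onBoundary p
    ΣBoundary = Σ³ (suc n) Boundary

    split : ∀ p → does (solution? p) ≡ does (regular? p) xor Boundary p
    split (x , y , z) with does (solution? (x , y , z)) | does (x + z ≟ y)
    ... | false | _     = refl
    ... | true  | false = refl
    ... | true  | true  = refl

    inBox : ∀ p → does (regular? p) ≡ true → InBox (suc n) p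
    inBox p reg = solution-inBox p (proj₁ (dec-true⁻¹ (regular? p) reg))

    invol : ∀ p → does (regular? p) ≡ true → does (regular? (zagier p)) ≡ true × zagier (zagier p) ≡ p
    invol p reg with zagier-involution p (dec-true⁻¹ (regular? p) reg)
    ... | (reg′ , back) , _ = dec-true (regular? (zagier p)) reg′ , back

#smallDivisors : ℕ → Bool
#smallDivisors N = ParitySum.Σ (suc N) (λ d → does ((d ∣? N) ×-dec (d * d <? N)))
  where
  open import Data.Nat.Properties using (_<?_)
  open import Data.Nat.Divisibility using (_∣?_)
  open import Relation.Nullary using (does; _×-dec_)

module OneModFour (a : ℕ) where

  open import Data.Nat using (_+_; _∸_; _<_; _≤_; s≤s; z<s; >-nonZero)
  open import Data.Nat.Properties
  open import Data.Nat.Divisibility using (_∣?_; divides)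
  open import Data.Nat.Tactic.RingSolver using (solve-∀)
  open import Data.Bool using (false; _∧_; _xor_; not)
  open import Data.Bool.Properties using (xor-identityʳ; xor-comm; ∧-zeroʳ; ∧-identityʳ)
  open import Data.Product using (_,_; proj₁; proj₂)
  open import Data.Sum using (inj₁; inj₂)
  open import Data.Empty using (⊥-elim)
  open import Relation.Nullary using (yes; no; does; _×-dec_)
  open import Relation.Nullary.Decidable using (dec-true; dec-false)
  open import Relation.Binary.PropositionalEquality
  open import Function using (_∘′_; case_of_)
  open Basics
  open ParitySum
  open ≡-Reasoning

  n : ℕ
  n = suc (4 * a)

  n≡1+2[2a] : n ≡ suc (2 * (2 * a))
  n≡1+2[2a] = cong suc (*-assoc 2 2 a)

  open Zagier n (2 * a) n≡1+2[2a]

  #square : Bool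
  #square = Σ (suc n) (λ x → does (x * x ≟ n))

  #x²+4y²≡square+solutions : #x²+4y² n ≡ #square xor #solutions
  #x²+4y²≡square+solutions =
    trans (Σ-cong (suc n) column) (trans (Σ-distrib (suc n) _ _) (cong (#square xor_) (sym #solutions≡y=z)))
    where
    column : ∀ x → Σ (suc n) (λ y → does (x * x + 4 * (y * y) ≟ n))
                 ≡ does (x * x ≟ n) xor Σ (suc n) (λ y → does (solution? (x , y , y)))
    column x = begin
      Σ (suc n) (λ y → does (x * x + 4 * (y * y) ≟ n))
        ≡⟨ Σ-head n _ ⟩
      does (x * x + 0 ≟ n) xor Σ n (λ y → does (x * x + 4 * (suc y * suc y) ≟ n))
        ≡⟨ cong₂ _xor_ (cong (λ t → does (t ≟ n)) (+-identityʳ (x * x)))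
                       (Σ-cong n (λ y → does-⇔ (λ sol → sol , z<s , z<s) proj₁ (_ ≟ n) (solution? (x , suc y , suc y)))) ⟩
      does (x * x ≟ n) xor Σ n (λ y → does (solution? (x , suc y , suc y)))
        ≡⟨ cong (does (x * x ≟ n) xor_) drop-zero ⟨
      does (x * x ≟ n) xor Σ (suc n) (λ y → does (solution? (x , y , y)))          ∎
      where
      drop-zero : Σ (suc n) (λ y → does (solution? (x , y , y))) ≡ Σ n (λ y → does (solution? (x , suc y , suc y)))
      drop-zero = trans (Σ-head n _)
                        (cong (_xor Σ n (λ y → does (solution? (x , suc y , suc y)))) (∧-zeroʳ (does (x * x + 0 ≟ n))))

  cofactor-gap : ∀ x w → x * w ≡ n → x < w → ∃[ z ] w ≡ x + 4 * suc z
  cofactor-gap x w xw≡n x<w with even-or-odd x | even-or-odd w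
  ... | inj₁ (i , refl) | _ = ⊥-elim (even≢odd (i * w) (2 * a) (trans (sym (*-assoc 2 i w)) (trans xw≡n n≡1+2[2a])))
  ... | inj₂ _ | inj₁ (j , refl) = ⊥-elim (even≢odd (x * j) (2 * a) (trans (x[2j]≡2[xj] x j) (trans xw≡n n≡1+2[2a])))
    where
    x[2j]≡2[xj] : ∀ x j → 2 * (x * j) ≡ x * (2 * j)
    x[2j]≡2[xj] = solve-∀
  ... | inj₂ (i , refl) | inj₂ (j , refl) with <-offset (*-cancelˡ-< 2 i j (≤-pred x<w))
  ...   | d , refl with even-or-odd d
  ...     | inj₁ (t , refl) = ⊥-elim (even≢odd a (i * i + 2 * i * t + 2 * i + t)
                                (sym (*-cancelˡ-≡ _ _ 2 (suc-injective (trans (expand i t) (trans xw≡n n≡1+2[2a]))))))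
    where
    expand : ∀ i t → suc (2 * suc (2 * (i * i + 2 * i * t + 2 * i + t))) ≡ suc (2 * i) * suc (2 * (i + suc (2 * t)))
    expand = solve-∀
  ...     | inj₂ (z , refl) = z , gap i z
    where
    gap : ∀ i z → suc (2 * (i + suc (suc (2 * z)))) ≡ suc (2 * i) + 4 * suc z
    gap = solve-∀

  #diagonal≡#smallDivisors : #diagonalSolutions ≡ #smallDivisors n
  #diagonal≡#smallDivisors = Σ-cong (suc n) row
    where
    x[x+4z]≡x²+4xz : ∀ x z → (x + 4 * z) * x ≡ x * x + 4 * (x * z)
    x[x+4z]≡x²+4xz = solve-∀

    row : ∀ x → Σ (suc n) (λ z → does (solution? (x , x , z))) ≡ does ((x ∣? n) ×-dec (x * x <? n))
    row x with (x ∣? n) ×-dec (x * x <? n)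
    ... | no ¬small = trans (Σ-zero (suc n) (λ {z} _ → dec-false (solution? (x , x , z)) small))
                            (sym (dec-false ((x ∣? n) ×-dec (x * x <? n)) ¬small))
      where
      small : ∀ {z} → ¬ Solution (x , x , z)
      small {z} (sol , 0<x , 0<z) = ¬small ( divides (x + 4 * z) (sym (trans (x[x+4z]≡x²+4xz x z) sol))
                                           , subst (x * x <_) sol (m<m+n (x * x) (*-mono-< {0} {4} z<s (*-mono-< 0<x 0<z))))
    ... | yes (divides w n≡wx , x²<n) = begin
      Σ (suc n) (λ z → does (solution? (x , x , z)))
        ≡⟨ Σ-single (suc n) (suc z₀) z₀<n (λ {z} _ z≢ → dec-false (solution? (x , x , z)) (z≢ ∘′ unique)) ⟩
      does (solution? (x , x , suc z₀))              ≡⟨ dec-true (solution? (x , x , suc z₀)) (sol , 0<x , z<s) ⟩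
      true                                           ≡⟨ dec-true ((x ∣? n) ×-dec (x * x <? n)) (divides w n≡wx , x²<n) ⟨
      does ((x ∣? n) ×-dec (x * x <? n))             ∎
      where
      0<x : 0 < x
      0<x = n≢0⇒n>0 (λ x≡0 → case trans n≡wx (trans (cong (w *_) x≡0) (*-zeroʳ w)) of λ ())
      xw≡n = trans (*-comm x w) (sym n≡wx)
      gap = cofactor-gap x w xw≡n (*-cancelʳ-< x x w (subst (x * x <_) n≡wx x²<n))
      z₀ = proj₁ gap
      sol : x * x + 4 * (x * suc z₀) ≡ n
      sol = begin
        x * x + 4 * (x * suc z₀)  ≡⟨ x[x+4z]≡x²+4xz x (suc z₀) ⟨
        (x + 4 * suc z₀) * x      ≡⟨ cong (_* x) (proj₂ gap) ⟨
        w * x                     ≡⟨ n≡wx ⟨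
        n                         ∎
      z₀<n : suc z₀ < suc n
      z₀<n = s≤s (≤-trans (m≤n*m (suc z₀) x {{>-nonZero 0<x}})
                          (≤-trans (m≤n*m (x * suc z₀) 4) (m+n≡o⇒m≤o _ (x * x) (trans (+-comm _ (x * x)) sol))))
      unique : ∀ {z} → Solution (x , x , z) → z ≡ suc z₀
      unique (sol′ , _) =
        *-cancelˡ-≡ _ _ x {{>-nonZero 0<x}} (*-cancelˡ-≡ _ _ 4 (+-cancelˡ-≡ (x * x) _ _ (trans sol′ (sym sol))))

  x²+4[x+z]z≡[x+2z]² : ∀ x z → x * x + 4 * ((x + z) * z) ≡ (x + 2 * z) * (x + 2 * z)
  x²+4[x+z]z≡[x+2z]² = solve-∀

  #boundary-nonsquare : (∀ m → m * m ≢ n) → #boundarySolutions ≡ false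
  #boundary-nonsquare nonsquare = Σ-zero (suc n) (λ {x} _ → Σ-zero (suc n) (λ {z} _ → dec-false (solution? (x , x + z , z))
    (λ (sol , _) → nonsquare (x + 2 * z) (trans (sym (x²+4[x+z]z≡[x+2z]² x z)) sol))))

  #positive≤ : ∀ K → Σ (suc K) (λ z → does (0 <? z)) ≡ odd K
  #positive≤ zero    = refl
  #positive≤ (suc K) = trans (cong (_xor true) (#positive≤ K)) (xor-comm (odd K) true)

  module _ (K : ℕ) (m²≡n : suc (2 * K) * suc (2 * K) ≡ n) where

    private
      m = suc (2 * K)

      m≤n : m ≤ n
      m≤n = subst (m ≤_) m²≡n (n≤n*n m)

      boundary-root : ∀ {x z} → Solution (x , x + z , z) → x + 2 * z ≡ m
      boundary-root {x} {z} (sol , _) = square-injective (trans (sym (x²+4[x+z]z≡[x+2z]² x z)) (trans sol (sym m²≡n)))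

    #boundary-row : ∀ z → Σ (suc n) (λ x → does (solution? (x , x + z , z))) ≡ does (0 <? z) ∧ does (z ≤? K)
    #boundary-row z with (0 <? z) ×-dec (z ≤? K)
    ... | no ¬in-range = trans (Σ-zero (suc n) (λ {x} _ → dec-false (solution? (x , x + z , z)) out))
                               (sym (dec-false ((0 <? z) ×-dec (z ≤? K)) ¬in-range))
      where
      out : ∀ {x} → ¬ Solution (x , x + z , z)
      out {x} sol@(_ , _ , 0<z) = ¬in-range (0<z , ≤-pred (*-cancelˡ-< 2 z (suc K) 2z<2[1+K]))
        where
        2z<2[1+K] : 2 * z < 2 * suc K
        2z<2[1+K] = subst (2 * z <_) (sym (*-suc 2 K))
                          (s≤s (m+n≡o⇒m≤o (2 * z) x (trans (+-comm (2 * z) x) (boundary-root sol))))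
    ... | yes (0<z , z≤K) = begin
      Σ (suc n) (λ x → does (solution? (x , x + z , z)))
        ≡⟨ Σ-single (suc n) x₀ (s≤s (≤-trans (m∸n≤m m (2 * z)) m≤n)) others ⟩
      does (solution? (x₀ , x₀ + z , z))
        ≡⟨ dec-true (solution? (x₀ , x₀ + z , z)) (x₀-sol , ≤-trans 0<z (m≤n+m z x₀) , 0<z) ⟩
      true
        ≡⟨ dec-true ((0 <? z) ×-dec (z ≤? K)) (0<z , z≤K) ⟨
      does (0 <? z) ∧ does (z ≤? K)  ∎
      where
      x₀ = m ∸ 2 * z
      x₀+2z≡m : x₀ + 2 * z ≡ m
      x₀+2z≡m = m∸n+n≡m (≤-trans (*-monoʳ-≤ 2 z≤K) (n≤1+n _))
      x₀-sol : x₀ * x₀ + 4 * ((x₀ + z) * z) ≡ n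
      x₀-sol = trans (x²+4[x+z]z≡[x+2z]² x₀ z) (trans (cong (λ t → t * t) x₀+2z≡m) m²≡n)
      others : ∀ {x} → x < suc n → x ≢ x₀ → does (solution? (x , x + z , z)) ≡ false
      others {x} _ x≢x₀ = dec-false (solution? (x , x + z , z))
                                    (λ sol → x≢x₀ (+-cancelʳ-≡ (2 * z) x x₀ (trans (boundary-root sol) (sym x₀+2z≡m))))

    #boundary-square : #boundarySolutions ≡ odd K
    #boundary-square = begin
      #boundarySolutions                                                     ≡⟨ Σ-swap (suc n) (suc n) _ ⟩
      Σ (suc n) (λ z → Σ (suc n) (λ x → does (solution? (x , x + z , z))))  ≡⟨ Σ-cong (suc n) #boundary-row ⟩
      Σ (suc n) (λ z → does (0 <? z) ∧ does (z ≤? K))                       ≡⟨ Σ-extend (s≤s K≤n) beyond-K ⟩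
      Σ (suc K) (λ z → does (0 <? z) ∧ does (z ≤? K))                       ≡⟨ Σ-cong-< (suc K) up-to-K ⟩
      Σ (suc K) (λ z → does (0 <? z))                                       ≡⟨ #positive≤ K ⟩
      odd K                                                                 ∎
      where
      K≤n = ≤-trans (m≤m+n K (K + 0)) (≤-trans (n≤1+n _) m≤n)

      beyond-K : ∀ {z} → suc K ≤ z → z < suc n → does (0 <? z) ∧ does (z ≤? K) ≡ false
      beyond-K {z} K<z _ = trans (cong (does (0 <? z) ∧_) (dec-false (z ≤? K) (<⇒≱ K<z))) (∧-zeroʳ _)

      up-to-K : ∀ {z} → z < suc K → does (0 <? z) ∧ does (z ≤? K) ≡ does (0 <? z)
      up-to-K {z} z≤K = trans (cong (does (0 <? z) ∧_) (dec-true (z ≤? K) (≤-pred z≤K))) (∧-identityʳ _)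

  #x²+4y²≡square+divisors+boundary : #x²+4y² n ≡ #square xor (#smallDivisors n xor #boundarySolutions)
  #x²+4y²≡square+divisors+boundary =
    trans #x²+4y²≡square+solutions
          (cong (#square xor_) (trans #solutions≡diagonal+boundary (cong (_xor #boundarySolutions) #diagonal≡#smallDivisors)))

  #x²+4y²-nonsquare : (∀ m → m * m ≢ n) → #x²+4y² n ≡ #smallDivisors n
  #x²+4y²-nonsquare nonsquare = begin
    #x²+4y² n                                ≡⟨ #x²+4y²≡square+divisors+boundary ⟩
    #square xor (#smallDivisors n xor #boundarySolutions)
      ≡⟨ cong₂ (λ s t → s xor (#smallDivisors n xor t)) no-root (#boundary-nonsquare nonsquare) ⟩
    false xor (#smallDivisors n xor false)   ≡⟨ xor-identityʳ _ ⟩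
    #smallDivisors n                         ∎
    where
    no-root : #square ≡ false
    no-root = Σ-zero (suc n) (λ {x} _ → dec-false (x * x ≟ n) (nonsquare x))

  #x²+4y²-square : ∀ K → suc (2 * K) * suc (2 * K) ≡ n → #x²+4y² n ≡ not (#smallDivisors n xor odd K)
  #x²+4y²-square K m²≡n = begin
    #x²+4y² n                                ≡⟨ #x²+4y²≡square+divisors+boundary ⟩
    #square xor (#smallDivisors n xor #boundarySolutions)
      ≡⟨ cong₂ (λ s t → s xor (#smallDivisors n xor t)) one-root (#boundary-square K m²≡n) ⟩
    true xor (#smallDivisors n xor odd K)    ∎
    where
    m = suc (2 * K)
    one-root : #square ≡ true
    one-root = trans (Σ-single (suc n) m (s≤s (subst (m ≤_) m²≡n (n≤n*n m)))
                       (λ {x} _ x≢m → dec-false (x * x ≟ n) (λ x²≡n → x≢m (square-injective (trans x²≡n (sym m²≡n))))))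
                     (dec-true (m * m ≟ n) m²≡n)

module Valuation where

  open import Data.Nat using (_<_; _≤_; s≤s; z<s; >-nonZero; nonTrivial⇒n>1)
  open import Data.Nat.Properties
  open import Data.Nat.Divisibility
  open import Data.Nat.Primality
  open import Data.Nat.Primality.Factorisation using (factorise)
  open import Data.Nat.Coprimality using (Coprime; coprime-divisor)
  open import Data.Nat.Induction using (<-rec)
  open import Data.List using ([]; _∷_)
  open import Data.List.Relation.Unary.All using (_∷_)
  open import Data.Product using (_,_)
  open import Data.Sum using (inj₁; inj₂)
  open import Data.Empty using (⊥-elim)
  open import Relation.Nullary using (yes; no)
  open import Relation.Binary using (tri<; tri≈; tri>)
  open import Relation.Binary.PropositionalEquality
  open Basics

  prime>1 : ∀ {p} → Prime p → 1 < p
  prime>1 {p} p-prime = nonTrivial⇒n>1 p {{prime⇒nonTrivial p-prime}}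

  0<m*n⇒0<n : ∀ m {n} → 0 < m * n → 0 < n
  0<m*n⇒0<n m {zero}  0<m*0 = ⊥-elim (<-irrefl (sym (*-zeroʳ m)) 0<m*0)
  0<m*n⇒0<n m {suc n} _     = z<s

  0<divisor : ∀ {d N} → 0 < N → d ∣ N → 0 < d
  0<divisor {zero}  0<N 0∣N = ⊥-elim (<-irrefl (sym (0∣⇒≡0 0∣N)) 0<N)
  0<divisor {suc d} _   _   = z<s

  ^-monoʳ-∣ : ∀ p {a b} → a ≤ b → p ^ a ∣ p ^ b
  ^-monoʳ-∣ p {a} a≤b with ≤-offset a≤b
  ... | d , refl = subst (p ^ a ∣_) (sym (^-distribˡ-+-* p a d)) (m∣m*n (p ^ d))

  ∣p^e*m⇒∣m : ∀ {p d} → Prime p → ¬ p ∣ d → ∀ e m → d ∣ p ^ e * m → d ∣ m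
  ∣p^e*m⇒∣m {p} {d} p-prime p∤d zero    m d∣m = subst (d ∣_) (+-identityʳ m) d∣m
  ∣p^e*m⇒∣m {p} {d} p-prime p∤d (suc e) m d∣p^[1+e]m =
    ∣p^e*m⇒∣m p-prime p∤d e m (coprime-divisor d⊥p (subst (d ∣_) (*-assoc p (p ^ e) m) d∣p^[1+e]m))
    where
    d⊥p : Coprime d p
    d⊥p (i∣d , i∣p) with prime⇒irreducible p-prime i∣p
    ... | inj₁ i≡1 = i≡1
    ... | inj₂ refl = ⊥-elim (p∤d i∣d)

  prime∣q^k⇒≡q : ∀ {p q} → Prime p → Prime q → ∀ k → p ∣ q ^ k → p ≡ q
  prime∣q^k⇒≡q p-prime q-prime zero    p∣1 = ⊥-elim (<-irrefl (sym (∣1⇒≡1 p∣1)) (prime>1 p-prime))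
  prime∣q^k⇒≡q {p} {q} p-prime q-prime (suc k) p∣q^[1+k] with euclidsLemma q (q ^ k) p-prime p∣q^[1+k]
  ... | inj₂ p∣q^k = prime∣q^k⇒≡q p-prime q-prime k p∣q^k
  ... | inj₁ p∣q with prime⇒irreducible q-prime p∣q
  ...   | inj₁ p≡1 = ⊥-elim (<-irrefl (sym p≡1) (prime>1 p-prime))
  ...   | inj₂ p≡q = p≡q

  factor-out : ∀ {p} → Prime p → ∀ N → 0 < N → ∃[ e ] ∃[ M ] (N ≡ p ^ e * M × ¬ p ∣ M)
  factor-out {p} p-prime = <-rec _ step
    where
    step : ∀ N → (∀ {m} → m < N → 0 < m → ∃[ e ] ∃[ M ] (m ≡ p ^ e * M × ¬ p ∣ M)) →
           0 < N → ∃[ e ] ∃[ M ] (N ≡ p ^ e * M × ¬ p ∣ M)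
    step N IH 0<N with p ∣? N
    ... | no p∤N = 0 , N , sym (+-identityʳ N) , p∤N
    ... | yes (divides q N≡qp) with IH q<N 0<q
      where
      0<q = 0<m*n⇒0<n p (subst (0 <_) (trans N≡qp (*-comm q p)) 0<N)
      q<N = subst (q <_) (sym N≡qp) (subst (_< q * p) (*-identityʳ q) (*-monoʳ-< q {{>-nonZero 0<q}} (prime>1 p-prime)))
    ...   | e , M , q≡p^eM , p∤M = suc e , M , trans N≡qp (trans (cong (_* p) q≡p^eM) (rearrange (p ^ e) M p)) , p∤M
      where
      rearrange : ∀ a m p → a * m * p ≡ p * a * m
      rearrange a m p = trans (*-comm (a * m) p) (sym (*-assoc p a m))

  p^i∣p^e*m⇒i≤e : ∀ {p m} → Prime p → ¬ p ∣ m → ∀ e i → p ^ i ∣ p ^ e * m → i ≤ e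
  p^i∣p^e*m⇒i≤e {p} {m} p-prime p∤m e i p^i∣p^em with i ≤? e
  ... | yes i≤e = i≤e
  ... | no  i≰e = ⊥-elim (p∤m (*-cancelˡ-∣ (p ^ e) {{m^n≢0 p e {{prime⇒nonZero p-prime}}}} (∣-trans p^[1+e]∣p^i p^i∣p^em)))
    where
    p^[1+e]∣p^i : p ^ e * p ∣ p ^ i
    p^[1+e]∣p^i = subst (_∣ p ^ i) (*-comm p (p ^ e)) (^-monoʳ-∣ p (≰⇒> i≰e))

  valuation-exact : ∀ {p m} → Prime p → ¬ p ∣ m → ∀ e → IsValuation p (p ^ e * m) e
  valuation-exact p-prime p∤m e = m∣m*n _ , λ p^[1+e]∣ → <-irrefl refl (p^i∣p^e*m⇒i≤e p-prime p∤m e (suc e) p^[1+e]∣)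

  valuation-unique : ∀ {p N v w} → IsValuation p N v → IsValuation p N w → v ≡ w
  valuation-unique {p} {N} {v} {w} (p^v∣N , p^[1+v]∤N) (p^w∣N , p^[1+w]∤N) with <-cmp v w
  ... | tri< v<w _ _ = ⊥-elim (p^[1+v]∤N (∣-trans (^-monoʳ-∣ p v<w) p^w∣N))
  ... | tri≈ _ v≡w _ = v≡w
  ... | tri> _ _ w<v = ⊥-elim (p^[1+w]∤N (∣-trans (^-monoʳ-∣ p w<v) p^v∣N))

  valuation-coprime : ∀ {p m v} → Prime p → ¬ p ∣ m → IsValuation p m v → v ≡ 0
  valuation-coprime {p} {m} p-prime p∤m val =
    valuation-unique val (subst (λ t → IsValuation p t 0) (+-identityʳ m) (valuation-exact p-prime p∤m 0))

  module _ {p q} (p-prime : Prime p) (q-prime : Prime q) (q≢p : q ≢ p) (e m v : ℕ) where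

    private
      p∤q^k : ∀ k → ¬ p ∣ q ^ k
      p∤q^k k p∣q^k = q≢p (sym (prime∣q^k⇒≡q p-prime q-prime k p∣q^k))

    valuation-cofactor⁻ : IsValuation q (p ^ e * m) v → IsValuation q m v
    valuation-cofactor⁻ (q^v∣ , q^[1+v]∤) =
      ∣p^e*m⇒∣m p-prime (p∤q^k v) e m q^v∣ , λ q^[1+v]∣m → q^[1+v]∤ (∣n⇒∣m*n (p ^ e) q^[1+v]∣m)

    valuation-cofactor⁺ : IsValuation q m v → IsValuation q (p ^ e * m) v
    valuation-cofactor⁺ (q^v∣m , q^[1+v]∤m) =
      ∣n⇒∣m*n (p ^ e) q^v∣m , λ q^[1+v]∣ → q^[1+v]∤m (∣p^e*m⇒∣m p-prime (p∤q^k (suc v)) e m q^[1+v]∣)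

  prime-factor : ∀ N → 1 < N → ∃[ p ] (Prime p × p ∣ N)
  prime-factor (suc zero)      (s≤s ())
  prime-factor N@(suc (suc _)) _ with factorise N
  ... | record { factors = [] ; isFactorisation = () }
  ... | record { factors = p ∷ _ ; isFactorisation = N≡∏ ; factorsPrime = p-prime ∷ _ } =
    p , p-prime , subst (p ∣_) (sym N≡∏) (m∣m*n _)

module Squares where

  open import Data.Nat using (_+_; _<_; _≤_; z≤n; s≤s; >-nonZero)
  open import Data.Nat.Properties
  open import Data.Nat.DivMod using ([m+kn]%n≡m%n)
  open import Data.Nat.Divisibility
  open import Data.Nat.Primality
  open import Data.Nat.Induction using (<-rec)
  open import Data.Nat.Tactic.RingSolver using (solve-∀)
  open import Data.Fin using (Fin; toℕ; fromℕ<)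
  open import Data.Fin.Properties using (any?; toℕ-fromℕ<)
  open import Data.Product using (_,_; map)
  open import Data.Sum using (_⊎_; inj₁; inj₂)
  open import Relation.Nullary using (Dec)
  open import Relation.Nullary.Decidable using (map′)
  open import Relation.Binary.PropositionalEquality
  open import Function using (case_of_)
  open Basics
  open Valuation

  square? : ∀ N → Dec (∃[ m ] m * m ≡ N)
  square? N = map′ (map toℕ (λ e → e)) root-in-range (any? (λ (i : Fin (suc N)) → toℕ i * toℕ i ≟ N))
    where
    root-in-range : ∃[ m ] m * m ≡ N → ∃[ i ] toℕ {suc N} i * toℕ i ≡ N
    root-in-range (m , m²≡N) = fromℕ< m≤N , trans (cong (λ t → t * t) (toℕ-fromℕ< m≤N)) m²≡N
      where m≤N = s≤s (subst (m ≤_) m²≡N (n≤n*n m))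

  [p^f*s]²≡p^[f+f]*s² : ∀ p f s → (p ^ f * s) * (p ^ f * s) ≡ p ^ (f + f) * (s * s)
  [p^f*s]²≡p^[f+f]*s² p f s = trans (interchange (p ^ f) s) (cong (_* (s * s)) (sym (^-distribˡ-+-* p f f)))
    where
    interchange : ∀ a s → (a * s) * (a * s) ≡ (a * a) * (s * s)
    interchange = solve-∀

  prime∤s⇒∤s² : ∀ {q s} → Prime q → ¬ q ∣ s → ¬ q ∣ s * s
  prime∤s⇒∤s² {s = s} q-prime q∤s q∣s² with euclidsLemma s s q-prime q∣s²
  ... | inj₁ q∣s = q∤s q∣s
  ... | inj₂ q∣s = q∤s q∣s

  valuation-square : ∀ {q s} → Prime q → ¬ q ∣ s → ∀ f → IsValuation q ((q ^ f * s) * (q ^ f * s)) (f + f)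
  valuation-square {q} {s} q-prime q∤s f = subst (λ t → IsValuation q t (f + f)) (sym ([p^f*s]²≡p^[f+f]*s² q f s))
                                                 (valuation-exact q-prime (prime∤s⇒∤s² q-prime q∤s) (f + f))

  f+f%2≡0 : ∀ f → (f + f) % 2 ≡ 0
  f+f%2≡0 f = trans (cong (_% 2) (trans (cong (f +_) (sym (+-identityʳ f))) (*-comm 2 f))) ([m+kn]%n≡m%n 0 f 2)

  valuation-square-even : ∀ {q} → Prime q → ∀ s → 0 < s → ∀ v → IsValuation q (s * s) v → v % 2 ≡ 0
  valuation-square-even {q} q-prime s 0<s v val with factor-out q-prime s 0<s
  ... | f , s′ , refl , q∤s′ =
    subst (λ t → t % 2 ≡ 0) (valuation-unique {q} {v = f + f} {w = v} (valuation-square q-prime q∤s′ f) val) (f+f%2≡0 f)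

  cofactor< : ∀ {q M f M′} → Prime q → 0 < f → 0 < M′ → M ≡ q ^ f * M′ → M′ < M
  cofactor< {q} {M} {suc f} {M′} q-prime _ 0<M′ M≡q^fM′ =
    subst (M′ <_) (sym M≡q^fM′) (subst (_< q ^ suc f * M′) (*-identityˡ M′)
      (*-monoˡ-< M′ {{>-nonZero 0<M′}} (≤-trans (prime>1 q-prime) (m≤m*n q (q ^ f) {{q^f≢0}}))))
    where q^f≢0 = m^n≢0 q f {{prime⇒nonZero q-prime}}

  OddValuation : ℕ → Set
  OddValuation N = ∃[ p ] ∃[ e ] ∃[ M ] (Prime p × N ≡ p ^ e * M × ¬ p ∣ M × 0 < M × e % 2 ≡ 1)

  oddValuation-*ˡ : ∀ {q N} → Prime q → ¬ q ∣ N → ∀ k → OddValuation N → OddValuation (q ^ k * N)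
  oddValuation-*ˡ {q} {N} q-prime q∤N k (p , e , M , p-prime , N≡p^eM , p∤M , 0<M , e%2≡1) =
    p , e , q ^ k * M , p-prime , q^kN≡p^e[q^kM] , p∤q^kM , *-mono-< (m^n>0 q {{prime⇒nonZero q-prime}} k) 0<M , e%2≡1
    where
    q^kN≡p^e[q^kM] : q ^ k * N ≡ p ^ e * (q ^ k * M)
    q^kN≡p^e[q^kM] = trans (cong (q ^ k *_) N≡p^eM) (x*[y*z]≡y*[x*z] (q ^ k) (p ^ e) M)
      where
      x*[y*z]≡y*[x*z] : ∀ x y z → x * (y * z) ≡ y * (x * z)
      x*[y*z]≡y*[x*z] = solve-∀

    0<e : 0 < e
    0<e = n≢0⇒n>0 (λ e≡0 → case trans (sym (cong (_% 2) e≡0)) e%2≡1 of λ ())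

    p≢q : p ≢ q
    p≢q refl = q∤N (subst (p ∣_) (sym N≡p^eM)
                          (∣-trans (subst (_∣ p ^ e) (*-identityʳ p) (^-monoʳ-∣ p {1} {e} 0<e)) (m∣m*n M)))

    p∤q^kM : ¬ p ∣ q ^ k * M
    p∤q^kM p∣ with euclidsLemma (q ^ k) M p-prime p∣
    ... | inj₁ p∣q^k = p≢q (prime∣q^k⇒≡q p-prime q-prime k p∣q^k)
    ... | inj₂ p∣M   = p∤M p∣M

  square-or-oddValuation : ∀ N → 0 < N → (∃[ s ] N ≡ s * s) ⊎ OddValuation N
  square-or-oddValuation = <-rec _ step
    where
    step : ∀ N → (∀ {N′} → N′ < N → 0 < N′ → (∃[ s ] N′ ≡ s * s) ⊎ OddValuation N′) →
           0 < N → (∃[ s ] N ≡ s * s) ⊎ OddValuation N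
    step (suc zero)      IH _   = inj₁ (1 , refl)
    step N@(suc (suc _)) IH 0<N with prime-factor N (s≤s (s≤s z≤n))
    ... | q , q-prime , q∣N with factor-out q-prime N 0<N
    ...   | f , N′ , N≡q^fN′ , q∤N′ with even-or-odd f
    ...     | inj₂ (h , refl) = inj₂ (q , suc (2 * h) , N′ , q-prime , N≡q^fN′ , q∤N′ , 0<N′ , 1+2h%2≡1)
      where
      0<N′ = 0<m*n⇒0<n (q ^ suc (2 * h)) (subst (0 <_) N≡q^fN′ 0<N)
      1+2h%2≡1 = trans (cong (λ t → suc t % 2) (*-comm 2 h)) ([m+kn]%n≡m%n 1 h 2)
    ...     | inj₁ (h , refl) with IH (cofactor< q-prime 0<2h 0<N′ N≡q^fN′) 0<N′
      where
      0<N′ = 0<m*n⇒0<n (q ^ (2 * h)) (subst (0 <_) N≡q^fN′ 0<N)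
      0<2h : 0 < 2 * h
      0<2h = n≢0⇒n>0 (λ 2h≡0 → q∤N′ (subst (q ∣_) (trans N≡q^fN′ (trans (cong (λ k → q ^ k * N′) 2h≡0) (*-identityˡ N′)))
                                           q∣N))
    ...       | inj₁ (t , refl) = inj₁ (q ^ h * t , trans N≡q^fN′ (begin
      q ^ (2 * h) * (t * t)       ≡⟨ cong (λ k → q ^ (h + k) * (t * t)) (+-identityʳ h) ⟩
      q ^ (h + h) * (t * t)       ≡⟨ [p^f*s]²≡p^[f+f]*s² q h t ⟨
      (q ^ h * t) * (q ^ h * t)   ∎))
      where open ≡-Reasoning
    ...       | inj₂ odd-valuation =
      inj₂ (subst OddValuation (sym N≡q^fN′) (oddValuation-*ˡ q-prime q∤N′ (2 * h) odd-valuation))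

  even-valuations⇒square : ∀ M → 0 < M → (∀ q v → Prime q → IsValuation q M v → v % 2 ≡ 0) → ∃[ s ] M ≡ s * s
  even-valuations⇒square M 0<M even with square-or-oddValuation M 0<M
  ... | inj₁ square = square
  ... | inj₂ (p , e , M′ , p-prime , M≡p^eM′ , p∤M′ , _ , e%2≡1)
      with () ← trans (sym e%2≡1)
                      (even p e p-prime (subst (λ t → IsValuation p t e) (sym M≡p^eM′) (valuation-exact p-prime p∤M′ e)))

module DivisorCount where

  open import Data.Nat using (_+_; _<_; _≤_; s≤s; >-nonZero; _/_)
  open import Data.Nat.Properties
  open import Data.Nat.DivMod using (m*n/n≡m)
  open import Data.Nat.Divisibility
  open import Data.Nat.Primality
  open import Data.Nat.Tactic.RingSolver using (solve-∀)
  open import Data.Bool using (false; _xor_)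
  open import Data.Product using (_,_; proj₁; proj₂)
  open import Relation.Nullary using (Dec; yes; no; does; _×-dec_)
  open import Relation.Nullary.Decidable using (dec-true; dec-false)
  open import Relation.Binary using (tri<; tri≈; tri>)
  open import Relation.Binary.PropositionalEquality
  open import Function using (_∘′_; case_of_)
  open Basics
  open Valuation
  open Squares using (square?)
  open FiniteSum +-0-isCommutativeMonoid
  open ≡-Reasoning

  count : ℕ → (ℕ → Bool) → ℕ
  count N b = Σ N (λ i → [ b i ]· 1)

  odd-count : ∀ N b → odd (count N b) ≡ ParitySum.Σ N b
  odd-count zero    b = refl
  odd-count (suc N) b = trans (odd-+ (count N b) _) (cong₂ _xor_ (odd-count N b) (odd-if (b N)))

  Σ-const : ∀ N x → Σ N (λ _ → x) ≡ N * x
  Σ-const zero    x = refl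
  Σ-const (suc N) x = trans (cong (_+ x) (Σ-const N x)) (+-comm (N * x) x)

  τ τ< τ≡ τ> : ℕ → ℕ
  τ  N = count (suc N) (λ d → does (d ∣? N))
  τ< N = count (suc N) (λ d → does ((d ∣? N) ×-dec (d * d <? N)))
  τ≡ N = count (suc N) (λ d → does ((d ∣? N) ×-dec (d * d ≟ N)))
  τ> N = count (suc N) (λ d → does ((d ∣? N) ×-dec (N <? d * d)))

  τ≡τ<+τ≡+τ> : ∀ N → τ N ≡ τ< N + (τ≡ N + τ> N)
  τ≡τ<+τ≡+τ> N = trans (Σ-cong (suc N) split) (trans (Σ-distrib (suc N) _ _) (cong (τ< N +_) (Σ-distrib (suc N) _ _)))
    where
    split : ∀ d → [ does (d ∣? N) ]· 1
                ≡ [ does ((d ∣? N) ×-dec (d * d <? N)) ]· 1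
                  + ([ does ((d ∣? N) ×-dec (d * d ≟ N)) ]· 1 + [ does ((d ∣? N) ×-dec (N <? d * d)) ]· 1)
    split d with does (d ∣? N)
    ... | false = refl
    ... | true with <-cmp (d * d) N
    ...   | tri< lt ¬eq ¬gt rewrite dec-true (d * d <? N) lt | dec-false (d * d ≟ N) ¬eq | dec-false (N <? d * d) ¬gt = refl
    ...   | tri≈ ¬lt eq ¬gt rewrite dec-false (d * d <? N) ¬lt | dec-true (d * d ≟ N) eq | dec-false (N <? d * d) ¬gt = refl
    ...   | tri> ¬lt ¬eq gt rewrite dec-false (d * d <? N) ¬lt | dec-false (d * d ≟ N) ¬eq | dec-true (N <? d * d) gt = refl

  odd-τ<≡#smallDivisors : ∀ N → odd (τ< N) ≡ #smallDivisors N
  odd-τ<≡#smallDivisors N = odd-count (suc N) (λ d → does ((d ∣? N) ×-dec (d * d <? N)))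

  τ≡-square : ∀ m → τ≡ (m * m) ≡ 1
  τ≡-square m = trans (Σ-single (suc (m * m)) m (s≤s (n≤n*n m)) other)
                      (cong ([_]· 1) (dec-true ((m ∣? m * m) ×-dec (m * m ≟ m * m)) (m∣m*n m , refl)))
    where
    other : ∀ {d} → d < suc (m * m) → d ≢ m → [ does ((d ∣? m * m) ×-dec (d * d ≟ m * m)) ]· 1 ≡ 0
    other {d} _ d≢m = cong ([_]· 1) (dec-false ((d ∣? m * m) ×-dec (d * d ≟ m * m)) (d≢m ∘′ square-injective ∘′ proj₂))

  τ≡-nonsquare : ∀ N → (∀ m → m * m ≢ N) → τ≡ N ≡ 0
  τ≡-nonsquare N nonsquare =
    Σ-zero (suc N) (λ {d} _ → cong ([_]· 1) (dec-false ((d ∣? N) ×-dec (d * d ≟ N)) (nonsquare d ∘′ proj₂)))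

  -- d ↦ N / d, with the junk value 0 at d = 0 (never a divisor of N > 0).
  codivisor : ℕ → ℕ → ℕ
  codivisor N zero    = zero
  codivisor N (suc d) = N / suc d

  codivisor-≡ : ∀ {N d} q → N ≡ q * d → 0 < d → codivisor N d ≡ q
  codivisor-≡ {d = suc d} q N≡qd _ = trans (cong (_/ suc d) N≡qd) (m*n/n≡m q (suc d))

  τ>≡τ< : ∀ N → 0 < N → τ> N ≡ τ< N
  τ>≡τ< N 0<N = begin
    τ> N                                                        ≡⟨ Σ-cong (suc N) large↦small ⟩
    Σ (suc N) (λ d → [ does (d ∣? N) ]· small (codivisor N d))
      ≡⟨ Σ-reindex (suc N) (λ d → does (d ∣? N)) (codivisor N) small bounded involutive ⟩
    Σ (suc N) (λ d → [ does (d ∣? N) ]· small d)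
      ≡⟨ Σ-cong (suc N) (λ d → ·-∧ (does (d ∣? N)) (does (d * d <? N)) 1) ⟩
    τ< N                                                        ∎
    where
    small : ℕ → ℕ
    small d = [ does (d * d <? N) ]· 1

    0<factors : ∀ {q d} → N ≡ q * d → 0 < q × 0 < d
    0<factors {q} {d} N≡qd = 0<m*n⇒0<n d (subst (0 <_) (trans N≡qd (*-comm q d)) 0<N) , 0<m*n⇒0<n q (subst (0 <_) N≡qd 0<N)

    bounded : ∀ d → does (d ∣? N) ≡ true → d < suc N
    bounded d d∣N = s≤s (∣⇒≤ {{>-nonZero 0<N}} (dec-true⁻¹ (d ∣? N) d∣N))

    involutive : ∀ d → does (d ∣? N) ≡ true → does (codivisor N d ∣? N) ≡ true × codivisor N (codivisor N d) ≡ d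
    involutive d d∣N with dec-true⁻¹ (d ∣? N) d∣N
    ... | divides q N≡qd = let (0<q , 0<d) = 0<factors {q} {d} N≡qd ; N≡dq = trans N≡qd (*-comm q d) in
      subst (λ c → does (c ∣? N) ≡ true) (sym (codivisor-≡ q N≡qd 0<d)) (dec-true (q ∣? N) (divides d N≡dq)) ,
      trans (cong (codivisor N) (codivisor-≡ q N≡qd 0<d)) (codivisor-≡ d N≡dq 0<q)

    large↦small : ∀ d → [ does ((d ∣? N) ×-dec (N <? d * d)) ]· 1 ≡ [ does (d ∣? N) ]· small (codivisor N d)
    large↦small d with d ∣? N
    ... | no  _ = refl
    ... | yes (divides q N≡qd) = cong ([_]· 1) (trans (does-⇔ to from (N <? d * d) (q * q <? N))
                                                        (cong (λ c → does (c * c <? N)) (sym (codivisor-≡ q N≡qd 0<d))))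
      where
      0<q = proj₁ (0<factors {q} {d} N≡qd)
      0<d = proj₂ (0<factors {q} {d} N≡qd)
      to : N < d * d → q * q < N
      to N<d² = subst (q * q <_) (sym N≡qd) (*-monoʳ-< q {{>-nonZero 0<q}} (*-cancelʳ-< d q d (subst (_< d * d) N≡qd N<d²)))
      from : q * q < N → N < d * d
      from q²<N = subst (_< d * d) (sym N≡qd)
                        (*-monoˡ-< d {{>-nonZero 0<d}} (*-cancelˡ-< q q d (subst (q * q <_) N≡qd q²<N)))

  τ≡2τ<+τ≡ : ∀ N → 0 < N → τ N ≡ 2 * τ< N + τ≡ N
  τ≡2τ<+τ≡ N 0<N = begin
    τ N                        ≡⟨ τ≡τ<+τ≡+τ> N ⟩
    τ< N + (τ≡ N + τ> N)       ≡⟨ cong (λ t → τ< N + (τ≡ N + t)) (τ>≡τ< N 0<N) ⟩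
    τ< N + (τ≡ N + τ< N)       ≡⟨ rearrange (τ< N) (τ≡ N) ⟩
    2 * τ< N + τ≡ N            ∎
    where
    rearrange : ∀ a b → a + (b + a) ≡ 2 * a + b
    rearrange = solve-∀

  τ-square : ∀ m → 0 < m → τ (m * m) ≡ suc (2 * τ< (m * m))
  τ-square m 0<m = trans (τ≡2τ<+τ≡ (m * m) (*-mono-< 0<m 0<m)) (trans (cong (2 * τ< (m * m) +_) (τ≡-square m)) (+-comm _ 1))

  τ-nonsquare : ∀ N → 0 < N → (∀ m → m * m ≢ N) → τ N ≡ 2 * τ< N
  τ-nonsquare N 0<N nonsquare =
    trans (τ≡2τ<+τ≡ N 0<N) (trans (cong (2 * τ< N +_) (τ≡-nonsquare N nonsquare)) (+-identityʳ _))

  odd-τ⇒square : ∀ M → 0 < M → odd (τ M) ≡ true → ∃[ s ] M ≡ s * s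
  odd-τ⇒square M 0<M odd-τ with square? M
  ... | yes (s , s²≡M) = s , sym s²≡M
  ... | no  nonsquare  =
    case trans (sym odd-τ) (trans (cong odd (τ-nonsquare M 0<M (λ m m²≡M → nonsquare (m , m²≡M)))) (odd-2* (τ< M))) of λ ()

  module _ {p} (p-prime : Prime p) (e M : ℕ) (0<M : 0 < M) (p∤M : ¬ p ∣ M) where

    private
      N = p ^ e * M
      instance
        p^e≢0 = m^n≢0 p e {{prime⇒nonZero p-prime}}

      0<N : 0 < N
      0<N = *-mono-< (m^n>0 p {{prime⇒nonZero p-prime}} e) 0<M

      piece : ℕ → ℕ → ℕ → ℕ
      piece d i c = [ does ((p ^ i * c ≟ d) ×-dec (c ∣? M)) ]· 1

      p∤cofactor : ∀ {c} → c ∣ M → ¬ p ∣ c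
      p∤cofactor c∣M p∣c = p∤M (∣-trans p∣c c∣M)

      p-adic-unique : ∀ {i j c c′} → ¬ p ∣ c → ¬ p ∣ c′ → p ^ i * c ≡ p ^ j * c′ → i ≡ j × c ≡ c′
      p-adic-unique {i} {j} {c} {c′} p∤c p∤c′ eq = i≡j , *-cancelˡ-≡ c c′ (p ^ i) {{m^n≢0 p i {{prime⇒nonZero p-prime}}}}
                                                              (trans eq (cong (λ k → p ^ k * c′) (sym i≡j)))
        where
        i≡j = valuation-unique (valuation-exact p-prime p∤c i)
                               (subst (λ t → IsValuation p t j) (sym eq) (valuation-exact p-prime p∤c′ j))

      divisor-pieces : ∀ d → [ does (d ∣? N) ]· 1 ≡ Σ (suc e) (λ i → Σ (suc M) (piece d i))
      divisor-pieces d with d ∣? N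
      ... | no d∤N = sym (Σ-zero (suc e) (λ {i} i≤e → Σ-zero (suc M) (λ {c} _ → cong ([_]· 1)
                       (dec-false ((p ^ i * c ≟ d) ×-dec (c ∣? M))
                                  (λ (d≡ , c∣M) → d∤N (subst (_∣ N) d≡ (*-pres-∣ (^-monoʳ-∣ p (≤-pred i≤e)) c∣M)))))))
      ... | yes d∣N with factor-out p-prime d (0<divisor 0<N d∣N)
      ...   | i₀ , c₀ , d≡ , p∤c₀ = sym (begin
        Σ (suc e) (λ i → Σ (suc M) (piece d i))
          ≡⟨ Σ-single (suc e) i₀ (s≤s i₀≤e) (λ _ i≢i₀ → Σ-zero (suc M) (λ _ → other-i i≢i₀)) ⟩
        Σ (suc M) (piece d i₀)                   ≡⟨ Σ-single (suc M) c₀ (s≤s (∣⇒≤ {{>-nonZero 0<M}} c₀∣M)) (λ _ → other-c) ⟩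
        piece d i₀ c₀
          ≡⟨ cong ([_]· 1) (dec-true ((p ^ i₀ * c₀ ≟ d) ×-dec (c₀ ∣? M)) (sym d≡ , c₀∣M)) ⟩
        1                                        ∎)
        where
        c₀∣M : c₀ ∣ M
        c₀∣M = ∣p^e*m⇒∣m p-prime p∤c₀ e M (∣-trans (subst (c₀ ∣_) (sym d≡) (n∣m*n (p ^ i₀))) d∣N)
        i₀≤e : i₀ ≤ e
        i₀≤e = p^i∣p^e*m⇒i≤e p-prime p∤M e i₀ (∣-trans (subst (p ^ i₀ ∣_) (sym d≡) (m∣m*n c₀)) d∣N)
        other-i : ∀ {i c} → i ≢ i₀ → piece d i c ≡ 0
        other-i {i} {c} i≢i₀ = cong ([_]· 1) (dec-false ((p ^ i * c ≟ d) ×-dec (c ∣? M))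
                                 (λ (d≡′ , c∣M) → i≢i₀ (proj₁ (p-adic-unique (p∤cofactor c∣M) p∤c₀ (trans d≡′ d≡)))))
        other-c : ∀ {c} → c ≢ c₀ → piece d i₀ c ≡ 0
        other-c {c} c≢c₀ = cong ([_]· 1) (dec-false ((p ^ i₀ * c ≟ d) ×-dec (c ∣? M))
                             (λ (d≡′ , c∣M) → c≢c₀ (proj₂ (p-adic-unique {i₀} {i₀} (p∤cofactor c∣M) p∤c₀ (trans d≡′ d≡)))))

      pieces-of : ∀ {i} c → i ≤ e → Σ (suc N) (λ d → piece d i c) ≡ [ does (c ∣? M) ]· 1
      pieces-of {i} c i≤e = begin
        Σ (suc N) (λ d → piece d i c)
          ≡⟨ Σ-cong (suc N) (λ d → sym (·-∧ (does (p ^ i * c ≟ d)) (does (c ∣? M)) 1)) ⟩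
        Σ (suc N) (λ d → [ does (p ^ i * c ≟ d) ]· [ does (c ∣? M) ]· 1)  ≡⟨ Σ-delta (suc N) (p ^ i * c) _ ⟩
        [ does (p ^ i * c <? suc N) ]· [ does (c ∣? M) ]· 1               ≡⟨ in-range (c ∣? M) ⟩
        [ does (c ∣? M) ]· 1                                             ∎
        where
        in-range : (c∣M? : Dec (c ∣ M)) → [ does (p ^ i * c <? suc N) ]· [ does c∣M? ]· 1 ≡ [ does c∣M? ]· 1
        in-range (no  _)   = ·-zeroʳ _
        in-range (yes c∣M) = ·-yes (p ^ i * c <? suc N)
          (s≤s (*-mono-≤ (^-monoʳ-≤ p {{prime⇒nonZero p-prime}} i≤e) (∣⇒≤ {{>-nonZero 0<M}} c∣M)))

    τ-prime-power : τ (p ^ e * M) ≡ suc e * τ M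
    τ-prime-power = begin
      τ N                                                               ≡⟨ Σ-cong (suc N) divisor-pieces ⟩
      Σ (suc N) (λ d → Σ (suc e) (λ i → Σ (suc M) (piece d i)))         ≡⟨ Σ-swap (suc N) (suc e) _ ⟩
      Σ (suc e) (λ i → Σ (suc N) (λ d → Σ (suc M) (piece d i)))         ≡⟨ Σ-cong (suc e) (λ i → Σ-swap (suc N) (suc M) _) ⟩
      Σ (suc e) (λ i → Σ (suc M) (λ c → Σ (suc N) (λ d → piece d i c)))
        ≡⟨ Σ-cong-< (suc e) (λ i≤e → Σ-cong (suc M) (λ c → pieces-of c (≤-pred i≤e))) ⟩
      Σ (suc e) (λ _ → τ M)                                             ≡⟨ Σ-const (suc e) (τ M) ⟩
      suc e * τ M                                                       ∎

module OddArithmetic where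

  open import Data.Nat using (_+_)
  open import Data.Nat.Properties
  open import Data.Nat.DivMod using ([m+kn]%n≡m%n)
  open import Data.Nat.Tactic.RingSolver using (solve-∀)
  open import Data.Bool using (false; _∧_; _xor_; not)
  open import Data.Bool.Properties using (xor-identityʳ)
  open import Data.Product using (_,_)
  open import Data.Sum using (inj₁; inj₂)
  open import Data.Empty using (⊥-elim)
  open import Relation.Nullary using (does)
  open import Relation.Binary.PropositionalEquality
  open Basics

  odd-factorˡ : ∀ A B X → A * B ≡ suc (2 * X) → ∃[ u ] A ≡ suc (2 * u)
  odd-factorˡ A B X AB≡1+2X with even-or-odd A
  ... | inj₂ A-odd        = A-odd
  ... | inj₁ (u , refl) = ⊥-elim (even≢odd (u * B) X (trans (sym (*-assoc 2 u B)) AB≡1+2X))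

  odd-product-half : ∀ a b c → suc (2 * a) * suc (2 * b) ≡ suc (2 * c) → odd c ≡ odd a xor odd b
  odd-product-half a b c eq = begin
    odd c                              ≡⟨ cong odd c≡ ⟨
    odd (a + b + 2 * (a * b))          ≡⟨ odd-+ (a + b) (2 * (a * b)) ⟩
    odd (a + b) xor odd (2 * (a * b))  ≡⟨ cong₂ _xor_ (odd-+ a b) (odd-2* (a * b)) ⟩
    (odd a xor odd b) xor false        ≡⟨ xor-identityʳ _ ⟩
    odd a xor odd b                    ∎
    where
    open ≡-Reasoning
    expand : ∀ a b → suc (2 * a) * suc (2 * b) ≡ suc (2 * (a + b + 2 * (a * b)))
    expand = solve-∀
    c≡ : a + b + 2 * (a * b) ≡ c
    c≡ = *-cancelˡ-≡ _ _ 2 (suc-injective (trans (sym (expand a b)) eq))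

  odd-power : ∀ P f → ∃[ Q ] (suc (2 * P) ^ f ≡ suc (2 * Q) × odd Q ≡ odd f ∧ odd P)
  odd-power P zero    = 0 , refl , refl
  odd-power P (suc f) with odd-power P f
  ... | Q , p^f≡1+2Q , odd-Q = P + Q + 2 * (P * Q) , trans (cong (suc (2 * P) *_) p^f≡1+2Q) (expand P Q) , odd-next
    where
    expand : ∀ a b → suc (2 * a) * suc (2 * b) ≡ suc (2 * (a + b + 2 * (a * b)))
    expand = solve-∀
    odd-next : odd (P + Q + 2 * (P * Q)) ≡ not (odd f) ∧ odd P
    odd-next = trans (odd-product-half P Q (P + Q + 2 * (P * Q)) (expand P Q))
                     (trans (cong (odd P xor_) odd-Q) (absorb (odd f) (odd P)))
      where
      absorb : ∀ x y → y xor (x ∧ y) ≡ not x ∧ y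
      absorb false y     = xor-identityʳ y
      absorb true  false = refl
      absorb true  true  = refl

  half-odd-power-product : ∀ {p f m′ K K′ P} → p ≡ suc (2 * P) → m′ ≡ suc (2 * K′) → p ^ f * m′ ≡ suc (2 * K) →
                           odd K ≡ (odd f ∧ odd P) xor odd K′
  half-odd-power-product {f = f} {K = K} {K′} {P} refl refl m-odd with odd-power P f
  ... | Q , p^f≡1+2Q , odd-Q =
    trans (odd-product-half Q K′ K (trans (sym (cong (_* suc (2 * K′)) p^f≡1+2Q)) m-odd)) (cong (_xor odd K′) odd-Q)

  %4-shape : ∀ {m} r t → m ≡ r + t * 4 → m % 4 ≡ r % 4
  %4-shape r t refl = [m+kn]%n≡m%n r t 4

  1+2P%4≟1 : ∀ P → does (suc (2 * P) % 4 ≟ 1) ≡ not (odd P)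
  1+2P%4≟1 P with even-or-odd P
  ... | inj₁ (t , refl) = trans (cong (λ r → does (r ≟ 1)) (%4-shape 1 t (shape t))) (cong not (sym (odd-2* t)))
    where
    shape : ∀ t → suc (2 * (2 * t)) ≡ 1 + t * 4
    shape = solve-∀
  ... | inj₂ (t , refl) = trans (cong (λ r → does (r ≟ 1)) (%4-shape 3 t (shape t))) (cong not (sym (odd-1+2* t)))
    where
    shape : ∀ t → suc (2 * suc (2 * t)) ≡ 3 + t * 4
    shape = solve-∀

  f+f%4≟2 : ∀ f → does ((f + f) % 4 ≟ 2) ≡ odd f
  f+f%4≟2 f with even-or-odd f
  ... | inj₁ (t , refl) = trans (cong (λ r → does (r ≟ 2)) (%4-shape 0 t (shape t))) (sym (odd-2* t))
    where
    shape : ∀ t → 2 * t + 2 * t ≡ 0 + t * 4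
    shape = solve-∀
  ... | inj₂ (t , refl) = trans (cong (λ r → does (r ≟ 2)) (%4-shape 2 t (shape t))) (sym (odd-1+2* t))
    where
    shape : ∀ t → suc (2 * t) + suc (2 * t) ≡ 2 + t * 4
    shape = solve-∀

module SpecialPrimes where

  open import Data.Nat using (_+_; _<_; s≤s; z≤n; z<s)
  open import Data.Nat.Properties using (_≟_; <-irrefl; +-identityʳ; *-comm; *-assoc; *-mono-<; m^n>0)
  open import Data.Nat.Induction using (<-rec)
  open import Data.Nat.Divisibility using (_∣_; ∣1⇒≡1)
  open import Data.Nat.Primality using (Prime; prime⇒nonZero)
  open import Data.Bool using (false; _xor_; _∧_; not)
  open import Data.Bool.Properties using (not-distribˡ-xor; xor-annihilates-not)
  open import Data.List using (List; []; _∷_; length)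
  open import Data.List.Membership.Propositional using (_∈_)
  open import Data.List.Membership.Propositional.Properties.WithK using (unique∧set⇒bag)
  open import Data.List.Relation.Binary.BagAndSetEquality using (∼bag⇒↭)
  open import Data.List.Relation.Binary.Permutation.Propositional.Properties using (↭-length)
  open import Data.List.Relation.Unary.Any using (here; there)
  open import Data.List.Relation.Unary.All using (tabulate)
  open import Data.List.Relation.Unary.Unique.Propositional using (Unique; []; _∷_)
  open import Data.Product using (_,_; proj₁; proj₂)
  open import Data.Empty using (⊥-elim)
  open import Relation.Nullary using (Dec; yes; no; does; _×-dec_)
  open import Relation.Binary.PropositionalEquality
  open import Function using (_∘′_; case_of_)
  open import Function.Bundles using (mk⇔; Equivalence)
  open Basics
  open Valuation
  open DivisorCount using (τ; τ<; τ-square; τ-prime-power)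
  open OddArithmetic
  open Squares using ([p^f*s]²≡p^[f+f]*s²; prime∤s⇒∤s²; cofactor<)

  SpecialList : ℕ → List ℕ → Set
  SpecialList N L = Unique L × (∀ p → (p ∈ L) ⇔ Special N p)

  specialList-length : ∀ {N L L′} → SpecialList N L → SpecialList N L′ → length L ≡ length L′
  specialList-length (L-unique , L-special) (L′-unique , L′-special) = ↭-length (∼bag⇒↭ (unique∧set⇒bag L-unique L′-unique
    (λ {p} → mk⇔ (Equivalence.from (L′-special p) ∘′ Equivalence.to (L-special p))
                 (Equivalence.from (L-special p) ∘′ Equivalence.to (L′-special p)))))

  module _ {p M} (p-prime : Prime p) (p∤M : ¬ p ∣ M) (e : ℕ) where

    not-special : ¬ Special M p
    not-special (_ , _ , v , val , v%4≡2) =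
      case trans (sym (cong (_% 4) (valuation-coprime {p} {M} {v} p-prime p∤M val))) v%4≡2 of λ ()

    special-here⁺ : p % 4 ≡ 1 × e % 4 ≡ 2 → Special (p ^ e * M) p
    special-here⁺ (p%4≡1 , e%4≡2) = p-prime , p%4≡1 , e , valuation-exact p-prime p∤M e , e%4≡2

    special-here⁻ : Special (p ^ e * M) p → p % 4 ≡ 1 × e % 4 ≡ 2
    special-here⁻ (_ , p%4≡1 , v , val , v%4≡2) =
      p%4≡1 , subst (λ t → t % 4 ≡ 2) (valuation-unique {p} {v = v} {w = e} val (valuation-exact p-prime p∤M e)) v%4≡2

    special-elsewhere⁺ : ∀ {q} → Special M q → Special (p ^ e * M) q
    special-elsewhere⁺ {q} special@(q-prime , q%4≡1 , v , val , v%4≡2) =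
      q-prime , q%4≡1 , v , valuation-cofactor⁺ p-prime q-prime (λ { refl → not-special special }) e M v val , v%4≡2

    special-elsewhere⁻ : ∀ {q} → q ≢ p → Special (p ^ e * M) q → Special M q
    special-elsewhere⁻ q≢p (q-prime , q%4≡1 , v , val , v%4≡2) =
      q-prime , q%4≡1 , v , valuation-cofactor⁻ p-prime q-prime q≢p e M v val , v%4≡2

    specialList-extend : ∀ {L} → SpecialList M L →
      ∃[ L′ ] (SpecialList (p ^ e * M) L′ × odd (length L′) ≡ does ((p % 4 ≟ 1) ×-dec (e % 4 ≟ 2)) xor odd (length L))
    specialList-extend {L} (L-unique , L-special) = extend ((p % 4 ≟ 1) ×-dec (e % 4 ≟ 2))
      where
      from-L : ∀ {q} → q ∈ L → Special (p ^ e * M) q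
      from-L {q} q∈L = special-elsewhere⁺ (Equivalence.to (L-special q) q∈L)

      to-L : ∀ {q} → q ≢ p → Special (p ^ e * M) q → q ∈ L
      to-L {q} q≢p special = Equivalence.from (L-special q) (special-elsewhere⁻ q≢p special)

      extend : (here? : Dec (p % 4 ≡ 1 × e % 4 ≡ 2)) →
               ∃[ L′ ] (SpecialList (p ^ e * M) L′ × odd (length L′) ≡ does here? xor odd (length L))
      extend (yes here-special) = p ∷ L , (p∉L ∷ L-unique , λ q → mk⇔ to from) , refl
        where
        p∉L = tabulate (λ {q} q∈L p≡q → not-special (subst (Special M) (sym p≡q) (Equivalence.to (L-special q) q∈L)))
        to : ∀ {q} → q ∈ p ∷ L → Special (p ^ e * M) q
        to (here refl) = special-here⁺ here-special
        to (there q∈L) = from-L q∈L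
        from : ∀ {q} → Special (p ^ e * M) q → q ∈ p ∷ L
        from {q} special with q ≟ p
        ... | yes refl = here refl
        ... | no  q≢p  = there (to-L q≢p special)
      extend (no not-here) = L , (L-unique , λ q → mk⇔ from-L from) , refl
        where
        from : ∀ {q} → Special (p ^ e * M) q → q ∈ L
        from {q} special with q ≟ p
        ... | yes refl = ⊥-elim (not-here (special-here⁻ special))
        ... | no  q≢p  = to-L q≢p special

  odd-τ<-prime-power² : ∀ {p m′} → Prime p → ¬ p ∣ m′ → 0 < m′ → ∀ f →
                        odd (τ< ((p ^ f * m′) * (p ^ f * m′))) ≡ odd f xor odd (τ< (m′ * m′))
  odd-τ<-prime-power² {p} {m′} p-prime p∤m′ 0<m′ f = odd-product-half f (τ< (m′ * m′)) (τ< (m * m)) (sym (begin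
    suc (2 * τ< (m * m))                  ≡⟨ τ-square m (*-mono-< (m^n>0 p {{prime⇒nonZero p-prime}} f) 0<m′) ⟨
    τ (m * m)                             ≡⟨ cong τ ([p^f*s]²≡p^[f+f]*s² p f m′) ⟩
    τ (p ^ (f + f) * (m′ * m′))           ≡⟨ τ-prime-power p-prime (f + f) (m′ * m′) (*-mono-< 0<m′ 0<m′) (prime∤s⇒∤s² p-prime p∤m′) ⟩
    suc (f + f) * τ (m′ * m′)             ≡⟨ cong₂ (λ a b → suc a * b) (cong (f +_) (sym (+-identityʳ f))) (τ-square m′ 0<m′) ⟩
    suc (2 * f) * suc (2 * τ< (m′ * m′))  ∎))
    where
    open ≡-Reasoning
    m = p ^ f * m′

  xor-regroup : ∀ f P F K → (f xor F) xor ((f ∧ P) xor K) ≡ (not P ∧ f) xor (F xor K)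
  xor-regroup false false F K = refl
  xor-regroup false true  F K = refl
  xor-regroup true  false F K = sym (not-distribˡ-xor F K)
  xor-regroup true  true  F K = xor-annihilates-not F K

  SpecialParity : ℕ → ℕ → Set
  SpecialParity m K = ∃[ L ] (SpecialList (m * m) L × odd (length L) ≡ odd (τ< (m * m)) xor odd K)

  specialParity-prime-power : ∀ {p f m′ K K′ P} → Prime p → ¬ p ∣ m′ → 0 < m′ →
                              p ≡ suc (2 * P) → m′ ≡ suc (2 * K′) → p ^ f * m′ ≡ suc (2 * K) →
                              SpecialParity m′ K′ → SpecialParity (p ^ f * m′) K
  specialParity-prime-power {p} {f} {m′} {K} {K′} {P} p-prime p∤m′ 0<m′ p-odd m′-odd m-odd (L′ , L′-special , L′-parity) =
    L , L-special , (begin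
      odd (length L)
        ≡⟨ L-parity ⟩
      does ((p % 4 ≟ 1) ×-dec ((f + f) % 4 ≟ 2)) xor odd (length L′)
        ≡⟨ cong₂ _xor_ p-special L′-parity ⟩
      (not (odd P) ∧ odd f) xor (odd (τ< (m′ * m′)) xor odd K′)
        ≡⟨ xor-regroup (odd f) (odd P) _ _ ⟨
      (odd f xor odd (τ< (m′ * m′))) xor ((odd f ∧ odd P) xor odd K′)
        ≡⟨ cong₂ _xor_ (odd-τ<-prime-power² p-prime p∤m′ 0<m′ f) (half-odd-power-product {p} {f} {m′} {K} {K′} {P} p-odd m′-odd m-odd) ⟨
      odd (τ< ((p ^ f * m′) * (p ^ f * m′))) xor odd K  ∎)
    where
    open ≡-Reasoning
    extended = specialList-extend p-prime (prime∤s⇒∤s² p-prime p∤m′) (f + f) L′-special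
    L = proj₁ extended
    L-parity = proj₂ (proj₂ extended)
    L-special : SpecialList ((p ^ f * m′) * (p ^ f * m′)) L
    L-special = subst (λ t → SpecialList t L) (sym ([p^f*s]²≡p^[f+f]*s² p f m′)) (proj₁ (proj₂ extended))
    p-special : does ((p % 4 ≟ 1) ×-dec ((f + f) % 4 ≟ 2)) ≡ not (odd P) ∧ odd f
    p-special = cong₂ _∧_ (trans (cong (λ t → does (t % 4 ≟ 1)) p-odd) (1+2P%4≟1 P)) (f+f%4≟2 f)

  special-parity : ∀ m K → m ≡ suc (2 * K) → SpecialParity m K
  special-parity = <-rec _ step
    where
    nothing-special-in-1 : SpecialList 1 []
    nothing-special-in-1 = [] , λ q → mk⇔ (λ ())
      (λ special@(q-prime , _) → ⊥-elim (not-special q-prime (λ q∣1 → <-irrefl (sym (∣1⇒≡1 q∣1)) (prime>1 q-prime)) 0 special))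

    step : ∀ m → (∀ {m′} → m′ < m → ∀ K′ → m′ ≡ suc (2 * K′) → SpecialParity m′ K′) → ∀ K → m ≡ suc (2 * K) → SpecialParity m K
    step m IH zero    refl = [] , nothing-special-in-1 , refl
    step m IH (suc K) refl with prime-factor m (s≤s (s≤s z≤n))
    ... | p , p-prime , p∣m with factor-out p-prime m z<s
    ...   | zero   , m′ , m≡m′ , p∤m′ = ⊥-elim (p∤m′ (subst (p ∣_) (trans m≡m′ (+-identityʳ m′)) p∣m))
    ...   | suc f₀ , m′ , m≡p^fm′ , p∤m′ = subst (λ t → SpecialParity t (suc K)) (sym m≡p^fm′)
      (specialParity-prime-power {f = suc f₀} {K′ = proj₁ K′,m′≡} {P = proj₁ P,p≡} p-prime p∤m′ 0<m′ (proj₂ P,p≡) (proj₂ K′,m′≡) m-odd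
        (IH (cofactor< {f = suc f₀} p-prime z<s 0<m′ m≡p^fm′) (proj₁ K′,m′≡) (proj₂ K′,m′≡)))
      where
      0<m′ = 0<m*n⇒0<n (p ^ suc f₀) (subst (0 <_) m≡p^fm′ z<s)
      m-odd = sym m≡p^fm′
      K′,m′≡ = odd-factorˡ m′ (p ^ suc f₀) (suc K) (trans (*-comm m′ _) m-odd)
      P,p≡ = odd-factorˡ p (p ^ f₀ * m′) (suc K) (trans (sym (*-assoc p (p ^ f₀) m′)) m-odd)

module NonSquareCase (a : ℕ) where

  open import Data.Nat using (_+_; _<_; z<s)
  open import Data.Nat.Properties
  open import Data.Nat.DivMod using ([m+kn]%n≡m%n)
  open import Data.Nat.Divisibility using (_∣_)
  open import Data.Nat.Primality using (Prime)
  open import Data.Nat.Tactic.RingSolver using (solve-∀)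
  open import Data.Bool using (_∧_; not)
  open import Data.Product using (_,_)
  open import Data.Sum using (inj₁; inj₂)
  open import Data.Empty using (⊥-elim)
  open import Relation.Nullary using (yes; no)
  open import Relation.Binary.PropositionalEquality
  open import Function using (case_of_)
  open Basics
  open Valuation
  open Squares
  open DivisorCount
  open OddArithmetic

  N : ℕ
  N = suc (4 * a)

  N≡1+2[2a] : N ≡ suc (2 * (2 * a))
  N≡1+2[2a] = cong suc (*-assoc 2 2 a)

  module _ (nonsquare : ∀ m → m * m ≢ N) where

    τ<-prime-power : ∀ {p} → Prime p → ∀ e M → 0 < M → ¬ p ∣ M → N ≡ p ^ e * M → 2 * τ< N ≡ suc e * τ M
    τ<-prime-power {p} p-prime e M 0<M p∤M N≡p^eM = begin
      2 * τ< N          ≡⟨ τ-nonsquare N z<s nonsquare ⟨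
      τ N               ≡⟨ cong τ N≡p^eM ⟩
      τ (p ^ e * M)     ≡⟨ τ-prime-power p-prime e M 0<M p∤M ⟩
      suc e * τ M       ∎
      where open ≡-Reasoning

    oneOddPrime⇒odd-τ< : OneOddPrime N → odd (τ< N) ≡ true
    oneOddPrime⇒odd-τ< (p , p-prime , _ , p-valuation , other-valuations) with factor-out p-prime N z<s
    ... | e , M , N≡p^eM , p∤M = begin
      odd (τ< N)                    ≡⟨ cong odd τ<≡ ⟩
      odd (suc (2 * g) * τ M)       ≡⟨ odd-* (suc (2 * g)) (τ M) ⟩
      odd (suc (2 * g)) ∧ odd (τ M)  ≡⟨ cong₂ _∧_ (odd-1+2* g) odd-τM ⟩
      true                          ∎
      where
      open ≡-Reasoning
      0<M = 0<m*n⇒0<n (p ^ e) (subst (0 <_) N≡p^eM z<s)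
      g = e / 4
        where open import Data.Nat using (_/_)
      e≡1+4g : e ≡ suc (4 * g)
      e≡1+4g = %4≡1⇒≡1+4[/4] e (p-valuation e (subst (λ t → IsValuation p t e) (sym N≡p^eM) (valuation-exact p-prime p∤M e)))
      M-even : ∀ q v → Prime q → IsValuation q M v → v % 2 ≡ 0
      M-even q v q-prime val with q ≟ p
      ... | yes refl = cong (_% 2) (valuation-coprime {q} {M} {v} p-prime p∤M val)
      ... | no  q≢p  = other-valuations q q-prime q≢p v
                         (subst (λ t → IsValuation q t v) (sym N≡p^eM) (valuation-cofactor⁺ p-prime q-prime q≢p e M v val))
      odd-τM : odd (τ M) ≡ true
      odd-τM with even-valuations⇒square M 0<M M-even
      ... | s , refl = trans (cong odd (τ-square s (0<m*n⇒0<n s 0<M))) (odd-1+2* (τ< (s * s)))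
      τ<≡ : τ< N ≡ suc (2 * g) * τ M
      τ<≡ = *-cancelˡ-≡ _ _ 2 (trans (τ<-prime-power p-prime e M 0<M p∤M N≡p^eM)
                                      (trans (cong (λ t → suc t * τ M) e≡1+4g) (double (τ M) g)))
        where
        double : ∀ t g → suc (suc (4 * g)) * t ≡ 2 * (suc (2 * g) * t)
        double = solve-∀

    p*square≡1mod4 : ∀ p W → N ≡ p * (W * W) → p % 4 ≡ 1
    p*square≡1mod4 p W N≡pW² with odd-factorˡ W (W * p) (2 * a) (trans (rearrange p W) (trans (sym N≡pW²) N≡1+2[2a]))
      where
      rearrange : ∀ p W → W * (W * p) ≡ p * (W * W)
      rearrange = solve-∀
    ... | u , refl = begin
      p % 4                               ≡⟨ [m+kn]%n≡m%n p (p * (u * u + u)) 4 ⟨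
      (p + p * (u * u + u) * 4) % 4       ≡⟨ cong (_% 4) (trans (sym (expand p u)) (sym N≡pW²)) ⟩
      N % 4                               ≡⟨ [1+4n]%4≡1 a ⟩
      1                                   ∎
      where
      open ≡-Reasoning
      expand : ∀ p u → p * (suc (2 * u) * suc (2 * u)) ≡ p + p * (u * u + u) * 4
      expand = solve-∀

    odd-τ<⇒oneOddPrime : odd (τ< N) ≡ true → OneOddPrime N
    odd-τ<⇒oneOddPrime odd-τ<N with square-or-oddValuation N z<s
    ... | inj₁ (s , N≡s²) = ⊥-elim (nonsquare s (sym N≡s²))
    ... | inj₂ (p , e , M , p-prime , N≡p^eM , p∤M , 0<M , e%2≡1) with even-or-odd e
    ...   | inj₁ (h , refl) = case trans (sym (%2≡1⇒odd (2 * h) e%2≡1)) (odd-2* h) of λ ()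
    ...   | inj₂ (h , refl) with ∧≡true⇒ {odd (suc h)} {odd (τ M)} odd-both | even-or-odd h
      where
      τ<≡ : τ< N ≡ suc h * τ M
      τ<≡ = *-cancelˡ-≡ _ _ 2 (trans (τ<-prime-power p-prime (suc (2 * h)) M 0<M p∤M N≡p^eM) (double (τ M) h))
        where
        double : ∀ t h → suc (suc (2 * h)) * t ≡ 2 * (suc h * t)
        double = solve-∀
      odd-both : odd (suc h) ∧ odd (τ M) ≡ true
      odd-both = trans (sym (odd-* (suc h) (τ M))) (trans (cong odd (sym τ<≡)) odd-τ<N)
    ...     | odd-1+h , _     | inj₂ (g , refl) = case trans (sym odd-1+h) (cong not (odd-1+2* g)) of λ ()
    ...     | _       , odd-τM | inj₁ (g , refl) with odd-τ⇒square M 0<M odd-τM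
    ...       | s , refl = p , p-prime , p*square≡1mod4 p (p ^ (2 * g) * s) N≡p[p^2g*s]² , p-valuation , other-valuations
      where
      e₀ = suc (2 * (2 * g))

      N≡p[p^2g*s]² : N ≡ p * ((p ^ (2 * g) * s) * (p ^ (2 * g) * s))
      N≡p[p^2g*s]² = begin
        N                                               ≡⟨ N≡p^eM ⟩
        p * p ^ (2 * (2 * g)) * (s * s)                 ≡⟨ *-assoc p _ (s * s) ⟩
        p * (p ^ (2 * (2 * g)) * (s * s))
          ≡⟨ cong (λ k → p * (p ^ (2 * g + k) * (s * s))) (+-identityʳ (2 * g)) ⟩
        p * (p ^ (2 * g + 2 * g) * (s * s))             ≡⟨ cong (p *_) ([p^f*s]²≡p^[f+f]*s² p (2 * g) s) ⟨
        p * ((p ^ (2 * g) * s) * (p ^ (2 * g) * s))     ∎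
        where open ≡-Reasoning

      p-valuation : ∀ v → IsValuation p N v → v % 4 ≡ 1
      p-valuation v val = trans (cong (_% 4) (valuation-unique {p} {v = v} {w = e₀} val
                                   (subst (λ t → IsValuation p t e₀) (sym N≡p^eM) (valuation-exact p-prime p∤M e₀))))
                                (trans (cong (λ t → suc t % 4) (sym (*-assoc 2 2 g))) ([1+4n]%4≡1 g))

      other-valuations : ∀ q → Prime q → q ≢ p → ∀ v → IsValuation q N v → v % 2 ≡ 0
      other-valuations q q-prime q≢p v val = valuation-square-even q-prime s (0<m*n⇒0<n s 0<M) v
        (valuation-cofactor⁻ p-prime q-prime q≢p e₀ (s * s) v (subst (λ t → IsValuation q t v) N≡p^eM val))

module Cases (S S̄ : ℕ → Bool) (S-squares : IsSquareSet S) (S̄-reciprocal : IsReciprocal S S̄) where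

  open import Data.Nat using (_/_)
  open import Data.Nat.Properties using (*-cancelˡ-≡; *-identityʳ)
  open import Data.Bool using (_xor_; not)
  open import Data.Bool.Properties using (not-involutive)
  open import Data.List using (length)
  open import Data.Product using (_,_; proj₁; proj₂; map₂)
  open import Relation.Binary.PropositionalEquality
  open import Function using (_∘′_)
  open import Function.Bundles using (mk⇔; Equivalence)
  open Basics
  open ReciprocalOfSquares S S̄ S-squares S̄-reciprocal
  open DivisorCount using (τ<; odd-τ<≡#smallDivisors)
  open SpecialPrimes using (SpecialList; special-parity; specialList-length)
  open OddArithmetic using (odd-factorˡ)

  k^2≡k*k : ∀ k → k ^ 2 ≡ k * k
  k^2≡k*k k = cong (k *_) (*-identityʳ k)

  even-case : ∀ n → n % 2 ≡ 0 → (S̄ n ≡ true) ⇔ (∃[ k ] n ≡ 2 * k ^ 2)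
  even-case n n%2≡0 = mk⇔ to from
    where
    m = n / 2
    n≡2m = %2≡0⇒≡2[/2] n n%2≡0
    S̄n≡Sm : S̄ n ≡ S m
    S̄n≡Sm = trans (cong S̄ n≡2m) (S̄-even m)
    to : S̄ n ≡ true → ∃[ k ] n ≡ 2 * k ^ 2
    to S̄n = map₂ (λ m≡k² → trans n≡2m (cong (2 *_) m≡k²)) (Equivalence.to (S-squares m) (trans (sym S̄n≡Sm) S̄n))
    from : ∃[ k ] n ≡ 2 * k ^ 2 → S̄ n ≡ true
    from (k , n≡2k²) = trans S̄n≡Sm (Equivalence.from (S-squares m) (k , *-cancelˡ-≡ m (k ^ 2) 2 (trans (sym n≡2m) n≡2k²)))

  nonsquare-case′ : ∀ a → ¬ (∃[ k ] suc (4 * a) ≡ k ^ 2) → (S̄ (suc (4 * a)) ≡ true) ⇔ OneOddPrime (suc (4 * a))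
  nonsquare-case′ a no-root =
    mk⇔ (odd-τ<⇒oneOddPrime nonsquare ∘′ trans (sym S̄≡odd-τ<)) (trans S̄≡odd-τ< ∘′ oneOddPrime⇒odd-τ< nonsquare)
    where
    open NonSquareCase a
    nonsquare : ∀ m → m * m ≢ N
    nonsquare m m²≡N = no-root (m , trans (sym m²≡N) (sym (k^2≡k*k m)))
    S̄≡odd-τ< : S̄ N ≡ odd (τ< N)
    S̄≡odd-τ< = trans (S̄-1mod4 a) (trans (OneModFour.#x²+4y²-nonsquare a nonsquare) (sym (odd-τ<≡#smallDivisors N)))

  nonsquare-case : ∀ n → n % 4 ≡ 1 → ¬ (∃[ k ] n ≡ k ^ 2) → (S̄ n ≡ true) ⇔ OneOddPrime n
  nonsquare-case n n%4≡1 = subst (λ t → ¬ (∃[ k ] t ≡ k ^ 2) → (S̄ t ≡ true) ⇔ OneOddPrime t)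
                                 (sym (%4≡1⇒≡1+4[/4] n n%4≡1)) (nonsquare-case′ (n / 4))

  square-case′ : ∀ a → (∃[ k ] suc (4 * a) ≡ k ^ 2) → (S̄ (suc (4 * a)) ≡ true) ⇔ EvenlyManySpecial (suc (4 * a))
  square-case′ a (k , N≡k^2) = mk⇔ to from
    where
    N = suc (4 * a)
    N≡k² : N ≡ k * k
    N≡k² = trans N≡k^2 (k^2≡k*k k)
    K,k≡ = odd-factorˡ k k (2 * a) (trans (sym N≡k²) (cong suc (*-assoc 2 2 a)))
      where open import Data.Nat.Properties using (*-assoc)
    K = proj₁ K,k≡
    k≡1+2K = proj₂ K,k≡

    specials = special-parity k K k≡1+2K
    L = proj₁ specials
    L-special : SpecialList N L
    L-special = subst (λ t → SpecialList t L) (sym N≡k²) (proj₁ (proj₂ specials))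

    S̄≡even-L : S̄ N ≡ not (odd (length L))
    S̄≡even-L = begin
      S̄ N                                   ≡⟨ S̄-1mod4 a ⟩
      #x²+4y² N
        ≡⟨ OneModFour.#x²+4y²-square a K (trans (cong (λ t → t * t) (sym k≡1+2K)) (sym N≡k²)) ⟩
      not (#smallDivisors N xor odd K)      ≡⟨ cong (λ t → not (t xor odd K)) (odd-τ<≡#smallDivisors N) ⟨
      not (odd (τ< N) xor odd K)            ≡⟨ cong (λ t → not (odd (τ< t) xor odd K)) N≡k² ⟩
      not (odd (τ< (k * k)) xor odd K)      ≡⟨ cong not (proj₂ (proj₂ specials)) ⟨
      not (odd (length L))                  ∎
      where open ≡-Reasoning

    to : S̄ N ≡ true → EvenlyManySpecial N
    to S̄N = L , proj₁ L-special , proj₂ L-special ,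
            even⇒%2≡0 (length L) (trans (sym (not-involutive _)) (cong not (trans (sym S̄≡even-L) S̄N)))

    from : EvenlyManySpecial N → S̄ N ≡ true
    from (L′ , L′-unique , L′-special , even) = trans S̄≡even-L (cong not (trans (cong odd (specialList-length L-special (L′-unique , L′-special)))
                                                                                (%2≡0⇒even (length L′) even)))

  square-case : ∀ n → n % 4 ≡ 1 → (∃[ k ] n ≡ k ^ 2) → (S̄ n ≡ true) ⇔ EvenlyManySpecial n
  square-case n n%4≡1 = subst (λ t → (∃[ k ] t ≡ k ^ 2) → (S̄ t ≡ true) ⇔ EvenlyManySpecial t)
                              (sym (%4≡1⇒≡1+4[/4] n n%4≡1)) (square-case′ (n / 4))

theorem6p2 : (S S̄ : ℕ → Bool) → IsSquareSet S → IsReciprocal S S̄ → (n : ℕ) →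
    ((n % 2 ≡ 0 → ((S̄ n ≡ true) ⇔ (∃[ k ] n ≡ 2 * k ^ 2)))
    × (n % 4 ≡ 1 → ¬ (∃[ k ] n ≡ k ^ 2) → ((S̄ n ≡ true) ⇔ OneOddPrime n))
    × (n % 4 ≡ 1 → (∃[ k ] n ≡ k ^ 2) → ((S̄ n ≡ true) ⇔ EvenlyManySpecial n)))
theorem6p2 S S̄ S-squares S̄-reciprocal n = even-case n , nonsquare-case n , square-case n
  where
  open Cases S S̄ S-squares S̄-reciprocal
  open import Data.Product using (_,_)
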